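{- Assume $n\in\mathbb{N}$ is not squarefree. Then $a(0,n)=1$, and the coefficient triple $\bigl(a(1,n),a(2,n),a(3,n)\bigr)$ has exactly one of the following five values: $(0,1,0),\ (0,0,1),\ (0,0,0),\ (0,0,-1),\ (0,-1,0)$.
   Context: For $n\in\mathbb{N}$, $\Phi_n(z)=\prod_{1\le j\le n,\ \gcd(j,n)=1}(z-e^{2\pi i j/n})$ is the $n$-th cyclotomic polynomial, of degree $\varphi(n)$ (Euler totient). Its coefficients are labelled $a(j,n)$ via $\Phi_n(z)=\sum_{j=0}^{\varphi(n)}a(j,n)z^{\varphi(n)-j}$ (so $a(j,n)$ is the coefficient of $z^{\varphi(n)-j}$), and $a(j,n)=0$ for $j>\varphi(n)$. An integer is squarefree if it is not divisible by $p^2$ for any prime $p$. -}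

module Defs where

open import Data.Nat using (ℕ; zero; suc; _<ᵇ_)
open import Data.Nat.Divisibility using (_∣_; _∣?_)
open import Data.Nat.Primality using (Prime)
open import Data.Integer using (ℤ; +_; -[1+_]; _+_; _-_; _*_)
open import Data.List using (List; []; _∷_; _++_; map; foldr; length; replicate; filter)
open import Data.Bool using (if_then_else_)
open import Data.Product using (_×_; _,_; proj₁; proj₂)
open import Relation.Nullary using (¬_)

SquareFree : ℕ → Set
SquareFree n = ∀ p → Prime p → ¬ ((p Data.Nat.* p) ∣ n)

-- A polynomial is represented by its list of integer coefficients in
-- DESCENDING order of degree: [c_0, c_1, …, c_d] stands for
-- c_0 z^d + c_1 z^(d-1) + … + c_d.  (So the j-th list entry of Φ_n is a(j,n).)
Poly : Set
Poly = List ℤ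

addL : Poly → Poly → Poly
addL []       q        = q
addL p        []       = p
addL (a ∷ p)  (b ∷ q)  = (a + b) ∷ addL p q

-- product (discrete convolution of coefficient lists; valid for descending
-- lists of exact length, since convolution is symmetric under reversal)
mulP : Poly → Poly → Poly
mulP []      q = []
mulP (a ∷ p) q = addL (map (a *_) q) ((+ 0) ∷ mulP p q)

zPowMinus1 : ℕ → Poly
zPowMinus1 zero    = []
zPowMinus1 (suc m) = (+ 1) ∷ (replicate m (+ 0) ++ (-[1+ 0 ] ∷ []))

subPrefix : Poly → Poly → Poly
subPrefix (x ∷ xs) (y ∷ ys) = (x - y) ∷ subPrefix xs ys
subPrefix xs       []       = xs
subPrefix []       (_ ∷ _)  = []

-- quotient of long division of f by the monic polynomial 1·z^k + gs
-- (gs = the k lower coefficients, descending); remainder discarded.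
-- The first argument is fuel (length f suffices).
divMonicGo : ℕ → Poly → Poly → Poly
divMonicGo zero    gs f       = []
divMonicGo (suc m) gs []      = []
divMonicGo (suc m) gs (c ∷ f) =
  if length f <ᵇ length gs then []
  else c ∷ divMonicGo m gs (subPrefix f (map (c *_) gs))

divMonic : Poly → Poly → Poly
divMonic f []       = f
divMonic f (_ ∷ gs) = divMonicGo (length f) gs f

-- Cyclotomic polynomials via z^n - 1 = ∏_{d ∣ n} Φ_d(z):
-- cycs n = [(1, Φ_1), …, (n, Φ_n)], with
-- Φ_n = (z^n - 1) / ∏_{d ∣ n, d < n} Φ_d   (exact division by a monic polynomial).
cycs : ℕ → List (ℕ × Poly)
cycs zero    = []
cycs (suc m) =
  cycs m ++ ((suc m , divMonic (zPowMinus1 (suc m))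
                        (foldr mulP ((+ 1) ∷ [])
                           (map proj₂ (filter (λ dp → proj₁ dp ∣? suc m) (cycs m))))) ∷ [])

lastPoly : List (ℕ × Poly) → Poly
lastPoly []            = []
lastPoly (x ∷ [])      = proj₂ x
lastPoly (_ ∷ y ∷ ys)  = lastPoly (y ∷ ys)

-- Φ_n as a descending coefficient list (meaningful for n ≥ 1)
Φ : ℕ → Poly
Φ n = lastPoly (cycs n)

nth0 : ℕ → Poly → ℤ
nth0 _       []       = + 0
nth0 zero    (x ∷ _)  = x
nth0 (suc j) (_ ∷ xs) = nth0 j xs

-- a(j,n): coefficient of z^(φ(n) - j) in Φ_n; 0 for j > φ(n)
a : ℕ → ℕ → ℤ
a j n = nth0 j (Φ n)

-- Keep only the four leading coefficients of a polynomial (its "jet"). Whenever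
-- φ(n) ≥ 3, i.e. n ∉ {1, 2, 3, 4, 6}, the identity z^n - 1 = ∏_{d ∣ n} Φ_d,
-- read through jets, holds exactly even though Φ_n is computed by a division
-- whose remainder is never shown to vanish; the excluded n are evaluated.
-- The Newton functionals newtonₖ (minus the k-th power sum of the roots) are
-- additive on monic jets, so Σ_{d ∣ n} newtonₖ(Φ_d) = -[n = 1] - k [n = k] for
-- k = 1, 2, 3. Möbius inversion gives a(1, n) = -μ(n) and, when μ(n) = 0,
-- a(k, n) = -μ(n/k) for k = 2, 3 (read as 0 unless k ∣ n). For n not squarefree
-- μ(n) = 0, and μ(n/2), μ(n/3) cannot both be nonzero: then n = 6m with m
-- squarefree and prime to 6, forcing μ(n) ≠ 0.

module Submission where

open import Defs
open import Data.Nat using (ℕ; _≥_)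
open import Data.Integer using (ℤ; +_; -[1+_])
open import Data.Product using (_×_; _,_)
open import Data.Sum using (_⊎_)
open import Relation.Binary.PropositionalEquality using (_≡_)
open import Relation.Nullary using (¬_)
open import Relation.Binary.PropositionalEquality using (sym; cong₂; subst)
open import Data.Nat using (zero; suc; pred)
open import Data.Nat.Divisibility using (_∣?_)
open import Data.List using (List; []; _∷_; _++_; filter)
open import Algebra.Structures using (IsCommutativeMonoid)

-- Since Poly lists coefficients from the top degree down, the first four
-- entries of a product depend only on the first four entries of the factors:
-- they multiply like power series truncated after degree 3.
module Jets where

  open import Data.Nat using (_≤_; s≤s)
  open import Data.Integer using (_+_; _-_; _*_)
  import Data.Integer.Properties as ℤ
  open import Data.Integer.Tactic.RingSolver using (solve-∀)
  open import Data.List using (map; replicate)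
  open import Relation.Binary.PropositionalEquality
  open ≡-Reasoning

  record Jet : Set where
    constructor mkJet
    field c₀ c₁ c₂ c₃ : ℤ

  open Jet public

  mkJet-cong : ∀ {a₀ a₁ a₂ a₃ b₀ b₁ b₂ b₃} → a₀ ≡ b₀ → a₁ ≡ b₁ → a₂ ≡ b₂ → a₃ ≡ b₃ →
               mkJet a₀ a₁ a₂ a₃ ≡ mkJet b₀ b₁ b₂ b₃
  mkJet-cong refl refl refl refl = refl

  jet : Poly → Jet
  jet p = mkJet (nth0 0 p) (nth0 1 p) (nth0 2 p) (nth0 3 p)

  0ʲ 1ʲ : Jet
  0ʲ = mkJet (+ 0) (+ 0) (+ 0) (+ 0)
  1ʲ = mkJet (+ 1) (+ 0) (+ 0) (+ 0)

  infixl 6 _+ʲ_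
  infixl 7 _*ʲ_ _·ʲ_

  _+ʲ_ _*ʲ_ : Jet → Jet → Jet
  mkJet a₀ a₁ a₂ a₃ +ʲ mkJet b₀ b₁ b₂ b₃ = mkJet (a₀ + b₀) (a₁ + b₁) (a₂ + b₂) (a₃ + b₃)
  mkJet a₀ a₁ a₂ a₃ *ʲ mkJet b₀ b₁ b₂ b₃ =
    mkJet (a₀ * b₀) (a₀ * b₁ + a₁ * b₀) (a₀ * b₂ + a₁ * b₁ + a₂ * b₀)
          (a₀ * b₃ + a₁ * b₂ + a₂ * b₁ + a₃ * b₀)

  _·ʲ_ : ℤ → Jet → Jet
  c ·ʲ mkJet a₀ a₁ a₂ a₃ = mkJet (c * a₀) (c * a₁) (c * a₂) (c * a₃)

  consʲ : ℤ → Jet → Jet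
  consʲ c (mkJet a₀ a₁ a₂ _) = mkJet c a₀ a₁ a₂

  +ʲ-identityʳ : ∀ u → u +ʲ 0ʲ ≡ u
  +ʲ-identityʳ (mkJet a₀ a₁ a₂ a₃) =
    mkJet-cong (ℤ.+-identityʳ a₀) (ℤ.+-identityʳ a₁) (ℤ.+-identityʳ a₂) (ℤ.+-identityʳ a₃)

  *ʲ-zeroˡ : ∀ u → 0ʲ *ʲ u ≡ 0ʲ
  *ʲ-zeroˡ (mkJet a₀ a₁ a₂ a₃) = mkJet-cong refl (l₁ a₀ a₁) (l₂ a₀ a₁ a₂) (l₃ a₀ a₁ a₂ a₃)
    where
    l₁ : ∀ a₀ a₁ → + 0 * a₁ + + 0 * a₀ ≡ + 0
    l₁ = solve-∀
    l₂ : ∀ a₀ a₁ a₂ → + 0 * a₂ + + 0 * a₁ + + 0 * a₀ ≡ + 0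
    l₂ = solve-∀
    l₃ : ∀ a₀ a₁ a₂ a₃ → + 0 * a₃ + + 0 * a₂ + + 0 * a₁ + + 0 * a₀ ≡ + 0
    l₃ = solve-∀

  consʲ-*ʲ : ∀ c u v → consʲ c u *ʲ v ≡ c ·ʲ v +ʲ consʲ (+ 0) (u *ʲ v)
  consʲ-*ʲ c (mkJet a₀ a₁ a₂ a₃) (mkJet b₀ b₁ b₂ b₃) =
    mkJet-cong (sym (ℤ.+-identityʳ (c * b₀))) refl (l₂ c a₀ a₁ b₀ b₁ b₂) (l₃ c a₀ a₁ a₂ b₀ b₁ b₂ b₃)
    where
    l₂ : ∀ c a₀ a₁ b₀ b₁ b₂ → c * b₂ + a₀ * b₁ + a₁ * b₀ ≡ c * b₂ + (a₀ * b₁ + a₁ * b₀)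
    l₂ = solve-∀
    l₃ : ∀ c a₀ a₁ a₂ b₀ b₁ b₂ b₃ →
         c * b₃ + a₀ * b₂ + a₁ * b₁ + a₂ * b₀ ≡ c * b₃ + (a₀ * b₂ + a₁ * b₁ + a₂ * b₀)
    l₃ = solve-∀

  nth0-addL : ∀ j p q → nth0 j (addL p q) ≡ nth0 j p + nth0 j q
  nth0-addL j       []      q       = sym (ℤ.+-identityˡ _)
  nth0-addL j       (x ∷ p) []      = sym (ℤ.+-identityʳ _)
  nth0-addL zero    (x ∷ p) (y ∷ q) = refl
  nth0-addL (suc j) (x ∷ p) (y ∷ q) = nth0-addL j p q

  nth0-map-* : ∀ j c q → nth0 j (map (c *_) q) ≡ c * nth0 j q
  nth0-map-* j       c []      = sym (ℤ.*-zeroʳ c)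
  nth0-map-* zero    c (x ∷ q) = refl
  nth0-map-* (suc j) c (x ∷ q) = nth0-map-* j c q

  jet-addL : ∀ p q → jet (addL p q) ≡ jet p +ʲ jet q
  jet-addL p q = mkJet-cong (nth0-addL 0 p q) (nth0-addL 1 p q) (nth0-addL 2 p q) (nth0-addL 3 p q)

  jet-map-* : ∀ c q → jet (map (c *_) q) ≡ c ·ʲ jet q
  jet-map-* c q = mkJet-cong (nth0-map-* 0 c q) (nth0-map-* 1 c q) (nth0-map-* 2 c q) (nth0-map-* 3 c q)

  jet-mulP : ∀ p q → jet (mulP p q) ≡ jet p *ʲ jet q
  jet-mulP []      q = sym (*ʲ-zeroˡ (jet q))
  jet-mulP (c ∷ p) q = begin
    jet (addL (map (c *_) q) (+ 0 ∷ mulP p q))    ≡⟨ jet-addL (map (c *_) q) (+ 0 ∷ mulP p q) ⟩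
    jet (map (c *_) q) +ʲ consʲ (+ 0) (jet (mulP p q))
      ≡⟨ cong₂ (λ u v → u +ʲ consʲ (+ 0) v) (jet-map-* c q) (jet-mulP p q) ⟩
    c ·ʲ jet q +ʲ consʲ (+ 0) (jet p *ʲ jet q)    ≡⟨ consʲ-*ʲ c (jet p) (jet q) ⟨
    jet (c ∷ p) *ʲ jet q                           ∎

  jet-padded : ∀ {k} r → 4 ≤ k → jet (replicate k (+ 0) ++ r) ≡ 0ʲ
  jet-padded r (s≤s (s≤s (s≤s (s≤s _)))) = refl

  Monicʲ : Jet → Set
  Monicʲ u = c₀ u ≡ + 1

  record IsAdditiveOnMonic (ℓ : Jet → ℤ) : Set where
    field
      ℓ-1ʲ : ℓ 1ʲ ≡ + 0
      ℓ-*ʲ : ∀ u v → Monicʲ u → Monicʲ v → ℓ (u *ʲ v) ≡ ℓ u + ℓ v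

  -- On a monic jet (1, -e₁, e₂, -e₃) the functional newtonₖ is minus the k-th
  -- power sum of the roots (Newton's identities), which is additive in the roots.
  newton₁ newton₂ newton₃ : Jet → ℤ
  newton₁ (mkJet _ a₁ _  _ ) = a₁
  newton₂ (mkJet _ a₁ a₂ _ ) = + 2 * a₂ - a₁ * a₁
  newton₃ (mkJet _ a₁ a₂ a₃) = + 3 * a₃ - + 3 * a₁ * a₂ + a₁ * a₁ * a₁

  newton₂-of-c₁≡0 : ∀ u → c₁ u ≡ + 0 → newton₂ u ≡ + 2 * c₂ u
  newton₂-of-c₁≡0 (mkJet _ _ a₂ _) refl = ℤ.+-identityʳ (+ 2 * a₂)

  newton₃-of-c₁≡0 : ∀ u → c₁ u ≡ + 0 → newton₃ u ≡ + 3 * c₃ u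
  newton₃-of-c₁≡0 (mkJet _ _ a₂ a₃) refl = trans (ℤ.+-identityʳ _) (ℤ.+-identityʳ (+ 3 * a₃))

  newton₁-additive : IsAdditiveOnMonic newton₁
  newton₁-additive = record { ℓ-1ʲ = refl ; ℓ-*ʲ = additive }
    where
    additive : ∀ u v → Monicʲ u → Monicʲ v → newton₁ (u *ʲ v) ≡ newton₁ u + newton₁ v
    additive (mkJet _ a₁ _ _) (mkJet _ b₁ _ _) refl refl = identity a₁ b₁
      where
      identity : ∀ a₁ b₁ → + 1 * b₁ + a₁ * + 1 ≡ a₁ + b₁
      identity = solve-∀

  newton₂-additive : IsAdditiveOnMonic newton₂
  newton₂-additive = record { ℓ-1ʲ = refl ; ℓ-*ʲ = additive }
    where
    additive : ∀ u v → Monicʲ u → Monicʲ v → newton₂ (u *ʲ v) ≡ newton₂ u + newton₂ v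
    additive (mkJet _ a₁ a₂ _) (mkJet _ b₁ b₂ _) refl refl = identity a₁ a₂ b₁ b₂
      where
      identity : ∀ a₁ a₂ b₁ b₂ →
        + 2 * (+ 1 * b₂ + a₁ * b₁ + a₂ * + 1) - (+ 1 * b₁ + a₁ * + 1) * (+ 1 * b₁ + a₁ * + 1)
        ≡ (+ 2 * a₂ - a₁ * a₁) + (+ 2 * b₂ - b₁ * b₁)
      identity = solve-∀

  newton₃-additive : IsAdditiveOnMonic newton₃
  newton₃-additive = record { ℓ-1ʲ = refl ; ℓ-*ʲ = additive }
    where
    additive : ∀ u v → Monicʲ u → Monicʲ v → newton₃ (u *ʲ v) ≡ newton₃ u + newton₃ v
    additive (mkJet _ a₁ a₂ a₃) (mkJet _ b₁ b₂ b₃) refl refl = identity a₁ a₂ a₃ b₁ b₂ b₃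
      where
      identity : ∀ a₁ a₂ a₃ b₁ b₂ b₃ →
        + 3 * (+ 1 * b₃ + a₁ * b₂ + a₂ * b₁ + a₃ * + 1)
          - + 3 * (+ 1 * b₁ + a₁ * + 1) * (+ 1 * b₂ + a₁ * b₁ + a₂ * + 1)
          + (+ 1 * b₁ + a₁ * + 1) * (+ 1 * b₁ + a₁ * + 1) * (+ 1 * b₁ + a₁ * + 1)
        ≡ (+ 3 * a₃ - + 3 * a₁ * a₂ + a₁ * a₁ * a₁) + (+ 3 * b₃ - + 3 * b₁ * b₂ + b₁ * b₁ * b₁)
      identity = solve-∀

module Polynomials where

  open Jets
  open import Data.Nat as ℕ using (_∸_; _⊔_; _≤_; _<ᵇ_; s≤s)
  import Data.Nat.Properties as ℕ
  open import Data.Integer using (_+_; _-_; _*_)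
  import Data.Integer.Properties as ℤ
  open import Data.Integer.Tactic.RingSolver using (solve-∀)
  open import Data.Bool using (true; false)
  open import Data.List using (map; length; replicate)
  import Data.List.Properties as List
  open import Data.Product using (∃; _,_)
  open import Relation.Nullary using (contradiction)
  open import Relation.Nullary.Reflects using (ofʸ; ofⁿ)
  open import Relation.Binary.PropositionalEquality
  open ≡-Reasoning

  addL-assoc : ∀ p q r → addL (addL p q) r ≡ addL p (addL q r)
  addL-assoc []      q       r       = refl
  addL-assoc (x ∷ p) []      r       = refl
  addL-assoc (x ∷ p) (y ∷ q) []      = refl
  addL-assoc (x ∷ p) (y ∷ q) (z ∷ r) = cong₂ _∷_ (ℤ.+-assoc x y z) (addL-assoc p q r)

  length-addL : ∀ p q → length (addL p q) ≡ length p ⊔ length q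
  length-addL []      q       = refl
  length-addL (x ∷ p) []      = sym (ℕ.⊔-identityʳ _)
  length-addL (x ∷ p) (y ∷ q) = cong suc (length-addL p q)

  length-mulP : ∀ x p y q → length (mulP (x ∷ p) (y ∷ q)) ≡ suc (length p ℕ.+ length q)
  length-mulP x []       y q = begin
    length (addL (map (x *_) (y ∷ q)) (+ 0 ∷ []))  ≡⟨ length-addL (map (x *_) (y ∷ q)) (+ 0 ∷ []) ⟩
    length (map (x *_) (y ∷ q)) ⊔ 1                ≡⟨ cong (_⊔ 1) (List.length-map (x *_) (y ∷ q)) ⟩
    suc (length q) ⊔ 1                             ≡⟨ cong suc (ℕ.⊔-identityʳ (length q)) ⟩
    suc (length q)                                 ∎
  length-mulP x (x′ ∷ p) y q = begin
    length (addL (map (x *_) (y ∷ q)) (+ 0 ∷ mulP (x′ ∷ p) (y ∷ q)))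
      ≡⟨ length-addL (map (x *_) (y ∷ q)) (+ 0 ∷ mulP (x′ ∷ p) (y ∷ q)) ⟩
    length (map (x *_) (y ∷ q)) ⊔ suc (length (mulP (x′ ∷ p) (y ∷ q)))
      ≡⟨ cong₂ _⊔_ (List.length-map (x *_) (y ∷ q)) (cong suc (length-mulP x′ p y q)) ⟩
    suc (length q) ⊔ suc (suc (length p ℕ.+ length q))
      ≡⟨ ℕ.m≤n⇒m⊔n≡n (s≤s (ℕ.m≤n⇒m≤1+n (ℕ.m≤n+m (length q) (length p)))) ⟩
    suc (suc (length p ℕ.+ length q)) ∎

  addL-subPrefix : ∀ xs ys → length ys ≤ length xs → addL ys (subPrefix xs ys) ≡ xs
  addL-subPrefix []       []       _         = refl
  addL-subPrefix (x ∷ xs) []       _         = refl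
  addL-subPrefix (x ∷ xs) (y ∷ ys) (s≤s ys≤) = cong₂ _∷_ (y+[x-y]≡x x y) (addL-subPrefix xs ys ys≤)
    where
    y+[x-y]≡x : ∀ x y → y + (x - y) ≡ x
    y+[x-y]≡x = solve-∀

  length-subPrefix : ∀ xs ys → length ys ≤ length xs → length (subPrefix xs ys) ≡ length xs
  length-subPrefix []       []       _         = refl
  length-subPrefix (x ∷ xs) []       _         = refl
  length-subPrefix (x ∷ xs) (y ∷ ys) (s≤s ys≤) = cong suc (length-subPrefix xs ys ys≤)

  divMonicGo-spec : ∀ fuel gs f → ∃ λ r →
    f ≡ addL (mulP (divMonicGo fuel gs f) (+ 1 ∷ gs))
             (replicate (length (divMonicGo fuel gs f)) (+ 0) ++ r)
  divMonicGo-spec zero    gs f        = f , refl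
  divMonicGo-spec (suc m) gs []       = [] , refl
  divMonicGo-spec (suc m) gs (c ∷ f)
    with length f <ᵇ length gs | ℕ.<ᵇ-reflects-< (length f) (length gs)
  ... | true  | _       = c ∷ f , refl
  ... | false | ofⁿ f≮gs with divMonicGo-spec m gs (subPrefix f (map (c *_) gs))
  ...   | r , f′≡ = r , cong₂ _∷_ (c≡c*1+0+0 c) f≡
    where
    c≡c*1+0+0 : ∀ c → c ≡ c * + 1 + + 0 + + 0
    c≡c*1+0+0 = solve-∀
    cgs = map (c *_) gs
    q′  = divMonicGo m gs (subPrefix f cgs)
    cgs≤f : length cgs ≤ length f
    cgs≤f = subst (_≤ length f) (sym (List.length-map (c *_) gs)) (ℕ.≮⇒≥ f≮gs)
    f≡ : f ≡ addL (addL cgs (mulP q′ (+ 1 ∷ gs))) (replicate (length q′) (+ 0) ++ r)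
    f≡ = begin
      f                                                    ≡⟨ addL-subPrefix f cgs cgs≤f ⟨
      addL cgs (subPrefix f cgs)                           ≡⟨ cong (addL cgs) f′≡ ⟩
      addL cgs (addL (mulP q′ (+ 1 ∷ gs)) (replicate (length q′) (+ 0) ++ r))
        ≡⟨ addL-assoc cgs (mulP q′ (+ 1 ∷ gs)) _ ⟨
      addL (addL cgs (mulP q′ (+ 1 ∷ gs))) (replicate (length q′) (+ 0) ++ r) ∎

  length-divMonicGo : ∀ fuel gs f → length f ≤ fuel →
                      length (divMonicGo fuel gs f) ≡ length f ∸ length gs
  length-divMonicGo zero    gs []      _ = sym (ℕ.0∸n≡0 (length gs))
  length-divMonicGo (suc m) gs []      _ = sym (ℕ.0∸n≡0 (length gs))
  length-divMonicGo (suc m) gs (c ∷ f) (s≤s f≤m)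
    with length f <ᵇ length gs | ℕ.<ᵇ-reflects-< (length f) (length gs)
  ... | true  | ofʸ f<gs = sym (ℕ.m≤n⇒m∸n≡0 f<gs)
  ... | false | ofⁿ f≮gs = begin
    suc (length (divMonicGo m gs f′))  ≡⟨ cong suc (length-divMonicGo m gs f′ (subst (_≤ m) (sym f′≡f) f≤m)) ⟩
    suc (length f′ ∸ length gs)        ≡⟨ cong (λ k → suc (k ∸ length gs)) f′≡f ⟩
    suc (length f ∸ length gs)         ≡⟨ ℕ.+-∸-assoc 1 (ℕ.≮⇒≥ f≮gs) ⟨
    suc (length f) ∸ length gs         ∎
    where
    f′ = subPrefix f (map (c *_) gs)
    f′≡f : length f′ ≡ length f
    f′≡f = length-subPrefix f (map (c *_) gs)
             (subst (_≤ length f) (sym (List.length-map (c *_) gs)) (ℕ.≮⇒≥ f≮gs))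

  head-divMonicGo : ∀ m gs c f → length gs ≤ length f → nth0 0 (divMonicGo (suc m) gs (c ∷ f)) ≡ c
  head-divMonicGo m gs c f gs≤f
    with length f <ᵇ length gs | ℕ.<ᵇ-reflects-< (length f) (length gs)
  ... | true  | ofʸ f<gs = contradiction gs≤f (ℕ.<⇒≱ f<gs)
  ... | false | _        = refl

  jet-divMonicGo : ∀ fuel gs f → 4 ≤ length (divMonicGo fuel gs f) →
                   jet f ≡ jet (divMonicGo fuel gs f) *ʲ jet (+ 1 ∷ gs)
  jet-divMonicGo fuel gs f 4≤q with divMonicGo-spec fuel gs f
  ... | r , f≡ = begin
    jet f                                                         ≡⟨ cong jet f≡ ⟩
    jet (addL (mulP q (+ 1 ∷ gs)) (replicate (length q) (+ 0) ++ r))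
      ≡⟨ jet-addL (mulP q (+ 1 ∷ gs)) _ ⟩
    jet (mulP q (+ 1 ∷ gs)) +ʲ jet (replicate (length q) (+ 0) ++ r)
      ≡⟨ cong₂ _+ʲ_ (jet-mulP q (+ 1 ∷ gs)) (jet-padded r 4≤q) ⟩
    jet q *ʲ jet (+ 1 ∷ gs) +ʲ 0ʲ                                 ≡⟨ +ʲ-identityʳ _ ⟩
    jet q *ʲ jet (+ 1 ∷ gs)                                       ∎
    where q = divMonicGo fuel gs f

  data MonicOfDegree : ℕ → Poly → Set where
    monic : ∀ t → MonicOfDegree (length t) (+ 1 ∷ t)

  monicOfDegree : ∀ {d p} → nth0 0 p ≡ + 1 → length p ≡ suc d → MonicOfDegree d p
  monicOfDegree {p = _ ∷ t} refl refl = monic t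

  monic⇒jet-monic : ∀ {d p} → MonicOfDegree d p → Monicʲ (jet p)
  monic⇒jet-monic (monic t) = refl

  monic⇒length : ∀ {d p} → MonicOfDegree d p → length p ≡ suc d
  monic⇒length (monic t) = refl

  mulP-monic : ∀ {m n p q} → MonicOfDegree m p → MonicOfDegree n q → MonicOfDegree (m ℕ.+ n) (mulP p q)
  mulP-monic (monic t) (monic u) = monicOfDegree refl (length-mulP (+ 1) t (+ 1) u)

  jet-divMonic : ∀ f {G g} → MonicOfDegree G g → 4 ≤ length (divMonic f g) →
                 jet f ≡ jet (divMonic f g) *ʲ jet g
  jet-divMonic f (monic gs) = jet-divMonicGo (length f) gs f

  length-zPowMinus1-tail : ∀ m → length (replicate m (+ 0) ++ -[1+ 0 ] ∷ []) ≡ suc m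
  length-zPowMinus1-tail m =
    trans (List.length-++ (replicate m (+ 0))) (trans (cong (ℕ._+ 1) (List.length-replicate m)) (ℕ.+-comm m 1))

  divMonic-zPowMinus1 : ∀ n {G g} → 1 ≤ n → G ≤ n → MonicOfDegree G g →
                        MonicOfDegree (n ∸ G) (divMonic (zPowMinus1 n) g)
  divMonic-zPowMinus1 (suc m) {G} _ G≤n (monic gs) = monicOfDegree head-q length-q
    where
    tail-f = replicate m (+ 0) ++ -[1+ 0 ] ∷ []
    f      = + 1 ∷ tail-f
    head-q : nth0 0 (divMonicGo (length f) gs f) ≡ + 1
    head-q = head-divMonicGo (length tail-f) gs (+ 1) tail-f
               (subst (G ≤_) (sym (length-zPowMinus1-tail m)) G≤n)
    length-q : length (divMonicGo (length f) gs f) ≡ suc (suc m ∸ G)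
    length-q = begin
      length (divMonicGo (length f) gs f)  ≡⟨ length-divMonicGo (length f) gs f ℕ.≤-refl ⟩
      suc (length tail-f) ∸ G              ≡⟨ cong (λ k → suc k ∸ G) (length-zPowMinus1-tail m) ⟩
      suc (suc m) ∸ G                      ≡⟨ ℕ.+-∸-assoc 1 G≤n ⟩
      suc (suc m ∸ G)                      ∎

-- range m = [1, …, m], listed in the same order as cycs m.
range : ℕ → List ℕ
range zero    = []
range (suc m) = range m ++ suc m ∷ []

properDivisors : ℕ → List ℕ
properDivisors n = filter (_∣? n) (range (pred n))

module IndexedSums {A : Set} {_∙_ : A → A → A} {ε : A}
                   (isCommutativeMonoid : IsCommutativeMonoid _≡_ _∙_ ε) where

  open import Level using (0ℓ)
  open import Algebra.Bundles using (CommutativeMonoid)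
  open import Data.Nat using (_+_; _*_; _≤_; _<_; _≟_; s≤s; z≤n; >-nonZero)
  import Data.Nat.Properties as ℕ
  open import Data.Nat.Divisibility using (_∣_; ∣-refl; n∣m*n; ∣m+n∣m⇒∣n; ∣⇒≤)
  open import Data.List using (map; foldr)
  open import Data.Product using (_,_)
  open import Function using (_∘_)
  open import Relation.Nullary using (Dec; yes; no; contradiction)
  open import Relation.Unary using (Decidable)
  open import Relation.Binary.PropositionalEquality
  open ≡-Reasoning

  open IsCommutativeMonoid isCommutativeMonoid using (assoc; identityˡ; identityʳ)

  commutativeMonoid : CommutativeMonoid 0ℓ 0ℓ
  commutativeMonoid = record
    { Carrier = A ; _≈_ = _≡_ ; _∙_ = _∙_ ; ε = ε ; isCommutativeMonoid = isCommutativeMonoid }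

  open import Algebra.Properties.CommutativeSemigroup
    (CommutativeMonoid.commutativeSemigroup commutativeMonoid) using (interchange)

  -- sumTo N t = t 1 ∙ t 2 ∙ ⋯ ∙ t N; index 0 is skipped.
  sumTo : ℕ → (ℕ → A) → A
  sumTo zero    t = ε
  sumTo (suc N) t = sumTo N t ∙ t (suc N)

  sumTo-cong : ∀ N {t u : ℕ → A} → (∀ k → 1 ≤ k → k ≤ N → t k ≡ u k) → sumTo N t ≡ sumTo N u
  sumTo-cong zero    t≗u = refl
  sumTo-cong (suc N) t≗u =
    cong₂ _∙_ (sumTo-cong N (λ k 1≤k k≤N → t≗u k 1≤k (ℕ.m≤n⇒m≤1+n k≤N))) (t≗u (suc N) (s≤s z≤n) ℕ.≤-refl)

  sumTo-ε : ∀ N (t : ℕ → A) → (∀ k → 1 ≤ k → k ≤ N → t k ≡ ε) → sumTo N t ≡ ε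
  sumTo-ε zero    t t≗ε = refl
  sumTo-ε (suc N) t t≗ε = begin
    sumTo N t ∙ t (suc N)  ≡⟨ cong₂ _∙_ (sumTo-ε N t (λ k 1≤k k≤N → t≗ε k 1≤k (ℕ.m≤n⇒m≤1+n k≤N)))
                                        (t≗ε (suc N) (s≤s z≤n) ℕ.≤-refl) ⟩
    ε ∙ ε                  ≡⟨ identityʳ ε ⟩
    ε                      ∎

  sumTo-distrib : ∀ N (t u : ℕ → A) → sumTo N (λ k → t k ∙ u k) ≡ sumTo N t ∙ sumTo N u
  sumTo-distrib zero    t u = sym (identityʳ ε)
  sumTo-distrib (suc N) t u = trans (cong (_∙ (t (suc N) ∙ u (suc N))) (sumTo-distrib N t u)) (interchange _ _ _ _)

  sumTo-+ : ∀ M K (t : ℕ → A) → sumTo (M + K) t ≡ sumTo M t ∙ sumTo K (λ i → t (M + i))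
  sumTo-+ M zero    t = trans (cong (λ N → sumTo N t) (ℕ.+-identityʳ M)) (sym (identityʳ _))
  sumTo-+ M (suc K) t = begin
    sumTo (M + suc K) t                                        ≡⟨ cong (λ N → sumTo N t) (ℕ.+-suc M K) ⟩
    sumTo (M + K) t ∙ t (suc (M + K))                          ≡⟨ cong (_∙ t (suc (M + K))) (sumTo-+ M K t) ⟩
    (sumTo M t ∙ sumTo K (λ i → t (M + i))) ∙ t (suc (M + K))  ≡⟨ assoc _ _ _ ⟩
    sumTo M t ∙ (sumTo K (λ i → t (M + i)) ∙ t (suc (M + K)))
      ≡⟨ cong (λ j → sumTo M t ∙ (sumTo K (λ i → t (M + i)) ∙ t j)) (ℕ.+-suc M K) ⟨
    sumTo M t ∙ sumTo (suc K) (λ i → t (M + i))                ∎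

  sumTo-extend : ∀ M N (t : ℕ → A) → M ≤ N → (∀ k → M < k → k ≤ N → t k ≡ ε) → sumTo N t ≡ sumTo M t
  sumTo-extend M N t M≤N tail≗ε with ℕ.m≤n⇒∃[o]m+o≡n M≤N
  ... | K , refl = begin
    sumTo (M + K) t                          ≡⟨ sumTo-+ M K t ⟩
    sumTo M t ∙ sumTo K (λ i → t (M + i))    ≡⟨ cong (sumTo M t ∙_) (sumTo-ε K _ tail′≗ε) ⟩
    sumTo M t ∙ ε                            ≡⟨ identityʳ _ ⟩
    sumTo M t                                ∎
    where
    tail′≗ε : ∀ i → 1 ≤ i → i ≤ K → t (M + i) ≡ ε
    tail′≗ε i 1≤i i≤K =
      tail≗ε (M + i) (subst (_≤ M + i) (ℕ.+-comm M 1) (ℕ.+-monoʳ-≤ M 1≤i)) (ℕ.+-monoʳ-≤ M i≤K)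

  sumTo-comm : ∀ N M (f : ℕ → ℕ → A) →
               sumTo N (λ i → sumTo M (f i)) ≡ sumTo M (λ j → sumTo N (λ i → f i j))
  sumTo-comm zero    M f = sym (sumTo-ε M _ (λ _ _ _ → refl))
  sumTo-comm (suc N) M f =
    trans (cong (_∙ sumTo M (f (suc N))) (sumTo-comm N M f)) (sym (sumTo-distrib M _ _))

  sumTo-single : ∀ N c (t : ℕ → A) → 1 ≤ c → c ≤ N →
                 (∀ k → 1 ≤ k → k ≤ N → k ≢ c → t k ≡ ε) → sumTo N t ≡ t c
  sumTo-single zero    (suc c) t 1≤c () others≗ε
  sumTo-single (suc N) c t 1≤c c≤N others≗ε with c ≟ suc N
  ... | yes refl = begin
    sumTo N t ∙ t (suc N)  ≡⟨ cong (_∙ t (suc N)) (sumTo-ε N t below≗ε) ⟩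
    ε ∙ t (suc N)          ≡⟨ identityˡ _ ⟩
    t (suc N)              ∎
    where
    below≗ε : ∀ k → 1 ≤ k → k ≤ N → t k ≡ ε
    below≗ε k 1≤k k≤N = others≗ε k 1≤k (ℕ.m≤n⇒m≤1+n k≤N) (λ { refl → ℕ.<-irrefl refl (s≤s k≤N) })
  ... | no c≢1+N = begin
    sumTo N t ∙ t (suc N)  ≡⟨ cong₂ _∙_ (sumTo-single N c t 1≤c c≤N′ below≗ε)
                                       (others≗ε (suc N) (s≤s z≤n) ℕ.≤-refl (c≢1+N ∘ sym)) ⟩
    t c ∙ ε                ≡⟨ identityʳ _ ⟩
    t c                    ∎
    where
    c≤N′ : c ≤ N
    c≤N′ = ℕ.≤-pred (ℕ.≤∧≢⇒< c≤N c≢1+N)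
    below≗ε : ∀ k → 1 ≤ k → k ≤ N → k ≢ c → t k ≡ ε
    below≗ε k 1≤k k≤N = others≗ε k 1≤k (ℕ.m≤n⇒m≤1+n k≤N)

  sumTo-multiples : ∀ m k (t : ℕ → A) → 1 ≤ k → (∀ d → ¬ (k ∣ d) → t d ≡ ε) →
                    sumTo (m * k) t ≡ sumTo m (λ i → t (i * k))
  sumTo-multiples zero    k t 1≤k t≗ε = refl
  sumTo-multiples (suc m) k t 1≤k t≗ε = begin
    sumTo (k + m * k) t                            ≡⟨ cong (λ N → sumTo N t) (ℕ.+-comm k (m * k)) ⟩
    sumTo (m * k + k) t                            ≡⟨ sumTo-+ (m * k) k t ⟩
    sumTo (m * k) t ∙ sumTo k (λ i → t (m * k + i)) ≡⟨ cong₂ _∙_ (sumTo-multiples m k t 1≤k t≗ε) block ⟩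
    sumTo m (λ i → t (i * k)) ∙ t (suc m * k)      ∎
    where
    block : sumTo k (λ i → t (m * k + i)) ≡ t (suc m * k)
    block = trans (sumTo-single k k _ 1≤k ℕ.≤-refl off≗ε) (cong t (ℕ.+-comm (m * k) k))
      where
      off≗ε : ∀ i → 1 ≤ i → i ≤ k → i ≢ k → t (m * k + i) ≡ ε
      off≗ε i 1≤i i≤k i≢k = t≗ε (m * k + i) λ k∣ →
        ℕ.<⇒≱ (ℕ.≤∧≢⇒< i≤k i≢k) (∣⇒≤ ⦃ >-nonZero 1≤i ⦄ (∣m+n∣m⇒∣n k∣ (n∣m*n m)))

  sumTo-homo : ∀ (h : A → A) → h ε ≡ ε → (∀ x y → h (x ∙ y) ≡ h x ∙ h y) →
               ∀ N t → h (sumTo N t) ≡ sumTo N (h ∘ t)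
  sumTo-homo h h-ε h-∙ zero    t = h-ε
  sumTo-homo h h-ε h-∙ (suc N) t =
    trans (h-∙ (sumTo N t) (t (suc N))) (cong (_∙ h (t (suc N))) (sumTo-homo h h-ε h-∙ N t))

  when : ∀ {P : Set} → Dec P → A → A
  when (yes _) x = x
  when (no _)  _ = ε

  when-yes : ∀ {P : Set} (P? : Dec P) {x} → P → when P? x ≡ x
  when-yes (yes _) p = refl
  when-yes (no ¬p) p = contradiction p ¬p

  when-no : ∀ {P : Set} (P? : Dec P) {x} → ¬ P → when P? x ≡ ε
  when-no (yes p) ¬p = contradiction p ¬p
  when-no (no _)  ¬p = refl

  when-⇔ : ∀ {P Q : Set} (P? : Dec P) (Q? : Dec Q) {x} → (P → Q) → (Q → P) → when P? x ≡ when Q? x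
  when-⇔ (yes p) Q? P→Q Q→P = sym (when-yes Q? (P→Q p))
  when-⇔ (no ¬p) Q? P→Q Q→P = sym (when-no Q? (¬p ∘ Q→P))

  when-ε : ∀ {P : Set} (P? : Dec P) → when P? ε ≡ ε
  when-ε (yes _) = refl
  when-ε (no _)  = refl

  when-∙ : ∀ {P : Set} (P? : Dec P) x y → when P? (x ∙ y) ≡ when P? x ∙ when P? y
  when-∙ (yes _) x y = refl
  when-∙ (no _)  x y = sym (identityʳ ε)

  when-homo : ∀ (h : A → A) → h ε ≡ ε → ∀ {P : Set} (P? : Dec P) x → h (when P? x) ≡ when P? (h x)
  when-homo h h-ε (yes _) x = refl
  when-homo h h-ε (no _)  x = h-ε

  divisorSum : ℕ → (ℕ → A) → A
  divisorSum n f = sumTo n (λ d → when (d ∣? n) (f d))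

  divisorSum-suc : ∀ m f → divisorSum (suc m) f ≡ sumTo m (λ d → when (d ∣? suc m) (f d)) ∙ f (suc m)
  divisorSum-suc m f = cong (sumTo m (λ d → when (d ∣? suc m) (f d)) ∙_) (when-yes (suc m ∣? suc m) ∣-refl)

  divisorSum-distrib : ∀ n f g → divisorSum n (λ d → f d ∙ g d) ≡ divisorSum n f ∙ divisorSum n g
  divisorSum-distrib n f g =
    trans (sumTo-cong n (λ d _ _ → when-∙ (d ∣? n) (f d) (g d))) (sumTo-distrib n _ _)

  divisorSum-homo : ∀ (h : A → A) → h ε ≡ ε → (∀ x y → h (x ∙ y) ≡ h x ∙ h y) →
                    ∀ n f → h (divisorSum n f) ≡ divisorSum n (h ∘ f)
  divisorSum-homo h h-ε h-∙ n f =
    trans (sumTo-homo h h-ε h-∙ n _) (sumTo-cong n (λ d _ _ → when-homo h h-ε (d ∣? n) (f d)))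

  sumList : List A → A
  sumList = foldr _∙_ ε

  sumList-filter-snoc : ∀ {P : ℕ → Set} (P? : Decidable P) (g : ℕ → A) xs x →
    sumList (map g (filter P? (xs ++ x ∷ []))) ≡ sumList (map g (filter P? xs)) ∙ when (P? x) (g x)
  sumList-filter-snoc P? g [] x with P? x
  ... | yes _ = trans (identityʳ (g x)) (sym (identityˡ (g x)))
  ... | no _  = sym (identityʳ ε)
  sumList-filter-snoc P? g (y ∷ ys) x with P? y
  ... | yes _ = trans (cong (g y ∙_) (sumList-filter-snoc P? g ys x)) (sym (assoc _ _ _))
  ... | no _  = sumList-filter-snoc P? g ys x

  sumList-filter-range : ∀ {P : ℕ → Set} (P? : Decidable P) (g : ℕ → A) m →
    sumList (map g (filter P? (range m))) ≡ sumTo m (λ d → when (P? d) (g d))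
  sumList-filter-range P? g zero    = refl
  sumList-filter-range P? g (suc m) =
    trans (sumList-filter-snoc P? g (range m) (suc m))
          (cong (_∙ when (P? (suc m)) (g (suc m))) (sumList-filter-range P? g m))

  divisorSum-properDivisors : ∀ m f → divisorSum (suc m) f ≡ sumList (map f (properDivisors (suc m))) ∙ f (suc m)
  divisorSum-properDivisors m f =
    trans (divisorSum-suc m f) (cong (_∙ f (suc m)) (sym (sumList-filter-range (_∣? suc m) f m)))

module Totient where

  open import Data.Nat using (_+_; _*_; _≤_; _<_; _≟_; s≤s; z≤n; NonZero; >-nonZero; ≢-nonZero)
  import Data.Nat.Properties as ℕ
  open import Data.Nat.Divisibility using (_∣_; divides; ∣-trans; ∣m+n∣m⇒∣n; m∣m*n; n∣m*n)
  open import Data.Nat.GCD using (gcd; gcd[m,n]∣m; gcd[m,n]∣n; gcd[m,n]≢0; c*gcd[m,n]≡gcd[cm,cn])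
  open import Data.Nat.Coprimality using (Coprime; coprime?; coprime-+; 1-coprimeTo; coprime-divisor;
                                          coprime⇒gcd≡1; gcd≡1⇒coprime)
  import Data.Nat.Coprimality as Coprime
  open import Data.Nat.Tactic.RingSolver using (solve-∀)
  open import Data.Product using (_,_)
  open import Data.Sum using (inj₂)
  open import Function using (_∘_)
  open import Relation.Nullary using (yes; no; contradiction)
  open import Relation.Binary.PropositionalEquality
  open IndexedSums ℕ.+-0-isCommutativeMonoid

  φ : ℕ → ℕ
  φ n = sumTo n (λ k → when (coprime? k n) 1)

  sumTo-1 : ∀ n → sumTo n (λ _ → 1) ≡ n
  sumTo-1 zero    = refl
  sumTo-1 (suc n) = trans (cong (_+ 1) (sumTo-1 n)) (ℕ.+-comm n 1)

  gcd-nonZero : ∀ k n → 1 ≤ n → NonZero (gcd k n)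
  gcd-nonZero k n 1≤n = ≢-nonZero (gcd[m,n]≢0 k n (inj₂ (λ { refl → ℕ.<-irrefl refl 1≤n })))

  count-cofactors-of-gcd : ∀ n k → 1 ≤ n → sumTo n (λ d → when (d * gcd k n ≟ n) 1) ≡ 1
  count-cofactors-of-gcd n k 1≤n with gcd[m,n]∣n k n
  ... | divides c n≡c*g =
    trans (sumTo-single n c _ 1≤c c≤n others≗0) (when-yes (c * gcd k n ≟ n) (sym n≡c*g))
    where
    instance _ = gcd-nonZero k n 1≤n
    1≤c : 1 ≤ c
    1≤c = ℕ.n≢0⇒n>0 (λ { refl → ℕ.<-irrefl (sym n≡c*g) 1≤n })
    c≤n : c ≤ n
    c≤n = subst (c ≤_) (sym n≡c*g) (ℕ.m≤m*n c (gcd k n))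
    others≗0 : ∀ d → 1 ≤ d → d ≤ n → d ≢ c → when (d * gcd k n ≟ n) 1 ≡ 0
    others≗0 d _ _ d≢c = when-no (d * gcd k n ≟ n) (d≢c ∘ λ eq → ℕ.*-cancelʳ-≡ d c (gcd k n) (trans eq n≡c*g))

  gcd-scale : ∀ i d g → gcd (i * g) (g * d) ≡ g * gcd i d
  gcd-scale i d g = trans (cong (λ x → gcd x (g * d)) (ℕ.*-comm i g)) (sym (c*gcd[m,n]≡gcd[cm,cn] g i d))

  cofactor-of-gcd⇒coprime : ∀ i d g .{{_ : NonZero (g * d)}} →
    d * gcd (i * g) (g * d) ≡ g * d → Coprime i d
  cofactor-of-gcd⇒coprime i d g eq = gcd≡1⇒coprime (ℕ.*-cancelˡ-≡ (gcd i d) 1 (g * d) (begin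
    g * d * gcd i d          ≡⟨ rearrange g d (gcd i d) ⟩
    d * (g * gcd i d)        ≡⟨ cong (d *_) (gcd-scale i d g) ⟨
    d * gcd (i * g) (g * d)  ≡⟨ eq ⟩
    g * d                    ≡⟨ ℕ.*-identityʳ (g * d) ⟨
    g * d * 1                ∎))
    where
    open ≡-Reasoning
    rearrange : ∀ g d x → g * d * x ≡ d * (g * x)
    rearrange = solve-∀

  coprime⇒cofactor-of-gcd : ∀ i d g → Coprime i d → d * gcd (i * g) (g * d) ≡ g * d
  coprime⇒cofactor-of-gcd i d g i⊥d = begin
    d * gcd (i * g) (g * d)  ≡⟨ cong (d *_) (gcd-scale i d g) ⟩
    d * (g * gcd i d)        ≡⟨ cong (λ x → d * (g * x)) (coprime⇒gcd≡1 i⊥d) ⟩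
    d * (g * 1)              ≡⟨ cong (d *_) (ℕ.*-identityʳ g) ⟩
    d * g                    ≡⟨ ℕ.*-comm d g ⟩
    g * d                    ∎
    where open ≡-Reasoning

  -- The k ≤ n with gcd(k, n) = n/d are the i · (n/d) with i ≤ d coprime to d.
  count-gcd-with-cofactor : ∀ n d → 1 ≤ n → 1 ≤ d →
    sumTo n (λ k → when (d * gcd k n ≟ n) 1) ≡ when (d ∣? n) (φ d)
  count-gcd-with-cofactor n d 1≤n 1≤d with d ∣? n
  ... | no d∤n = sumTo-ε n _ λ k _ _ → when-no (d * gcd k n ≟ n)
          λ eq → d∤n (divides (gcd k n) (trans (sym eq) (ℕ.*-comm d (gcd k n))))
  ... | yes (divides g refl) = begin
    sumTo (g * d) t                                     ≡⟨ cong (λ N → sumTo N t) (ℕ.*-comm g d) ⟩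
    sumTo (d * g) t                                     ≡⟨ sumTo-multiples d g t 1≤g off-multiples ⟩
    sumTo d (λ i → t (i * g))                           ≡⟨ sumTo-cong d on-multiples ⟩
    φ d                                                 ∎
    where
    open ≡-Reasoning
    t : ℕ → ℕ
    t k = when (d * gcd k (g * d) ≟ g * d) 1
    1≤g : 1 ≤ g
    1≤g = ℕ.n≢0⇒n>0 (λ { refl → ℕ.<-irrefl refl 1≤n })
    instance
      _ : NonZero (g * d)
      _ = >-nonZero 1≤n
    off-multiples : ∀ k → ¬ (g ∣ k) → t k ≡ 0
    off-multiples k g∤k = when-no (d * gcd k (g * d) ≟ g * d) λ eq →
      g∤k (subst (_∣ k) (ℕ.*-cancelˡ-≡ (gcd k (g * d)) g d ⦃ >-nonZero 1≤d ⦄ (trans eq (ℕ.*-comm g d)))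
                 (gcd[m,n]∣m k (g * d)))
    on-multiples : ∀ i → 1 ≤ i → i ≤ d → t (i * g) ≡ when (coprime? i d) 1
    on-multiples i _ _ = when-⇔ (d * gcd (i * g) (g * d) ≟ g * d) (coprime? i d)
                           (cofactor-of-gcd⇒coprime i d g) (coprime⇒cofactor-of-gcd i d g)

  -- Count the pairs (k, d) with d · gcd(k, n) = n in both orders.
  divisorSum-φ : ∀ n → 1 ≤ n → divisorSum n φ ≡ n
  divisorSum-φ n 1≤n = begin
    divisorSum n φ
      ≡⟨ sumTo-cong n (λ d 1≤d _ → count-gcd-with-cofactor n d 1≤n 1≤d) ⟨
    sumTo n (λ d → sumTo n (λ k → when (d * gcd k n ≟ n) 1))
      ≡⟨ sumTo-comm n n (λ k d → when (d * gcd k n ≟ n) 1) ⟨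
    sumTo n (λ k → sumTo n (λ d → when (d * gcd k n ≟ n) 1))
      ≡⟨ sumTo-cong n (λ k _ _ → count-cofactors-of-gcd n k 1≤n) ⟩
    sumTo n (λ _ → 1)
      ≡⟨ sumTo-1 n ⟩
    n ∎
    where open ≡-Reasoning

  sumTo-mono : ∀ M N t → M ≤ N → sumTo M t ≤ sumTo N t
  sumTo-mono M N t M≤N with ℕ.m≤n⇒∃[o]m+o≡n M≤N
  ... | K , refl = subst (sumTo M t ≤_) (sym (sumTo-+ M K t)) (ℕ.m≤m+n (sumTo M t) _)

  sumTo-three : ∀ N t a b c → 1 ≤ a → a < b → b < c → c ≤ N → t a + t b + t c ≤ sumTo N t
  sumTo-three N t (suc a) (suc b) (suc c) _ a<b b<c c≤N = begin
    t (suc a) + t (suc b) + t (suc c)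
      ≤⟨ ℕ.+-monoˡ-≤ (t (suc c)) (ℕ.+-monoˡ-≤ (t (suc b)) (ℕ.m≤n+m (t (suc a)) (sumTo a t))) ⟩
    sumTo (suc a) t + t (suc b) + t (suc c)
      ≤⟨ ℕ.+-monoˡ-≤ (t (suc c)) (ℕ.+-monoˡ-≤ (t (suc b)) (sumTo-mono (suc a) b t (ℕ.≤-pred a<b))) ⟩
    sumTo (suc b) t + t (suc c)
      ≤⟨ ℕ.+-monoˡ-≤ (t (suc c)) (sumTo-mono (suc b) c t (ℕ.≤-pred b<c)) ⟩
    sumTo (suc c) t
      ≤⟨ sumTo-mono (suc c) N t c≤N ⟩
    sumTo N t ∎
    where open ℕ.≤-Reasoning

  -- 1, b and c are three distinct residues coprime to n = c + 1.
  three≤φ : ∀ b c → 1 < b → b < c → Coprime b (suc c) → 3 ≤ φ (suc c)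
  three≤φ b c 1<b b<c b⊥n =
    subst (_≤ φ (suc c)) (cong₂ _+_ (cong₂ _+_ (when-yes (coprime? 1 (suc c)) (1-coprimeTo (suc c)))
                                               (when-yes (coprime? b (suc c)) b⊥n))
                                    (when-yes (coprime? c (suc c)) c⊥n))
          (sumTo-three (suc c) (λ k → when (coprime? k (suc c)) 1) 1 b c (s≤s z≤n) 1<b b<c (ℕ.n≤1+n c))
    where
    c⊥n : Coprime c (suc c)
    c⊥n = subst (Coprime c) (ℕ.+-comm c 1) (Coprime.sym (coprime-+ (1-coprimeTo c)))

  coprime-+-multiple : ∀ {b k m} → b ∣ m → Coprime b k → Coprime b (k + m)
  coprime-+-multiple {k = k} {m} b∣m b⊥k {d} (d∣b , d∣k+m) =
    b⊥k (d∣b , ∣m+n∣m⇒∣n (subst (d ∣_) (ℕ.+-comm k m) d∣k+m) (∣-trans d∣b b∣m))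

  coprime-to-square : ∀ {b m} → Coprime b m → Coprime b (m * m)
  coprime-to-square b⊥m (d∣b , d∣m*m) =
    b⊥m (d∣b , coprime-divisor (λ (e∣d , e∣m) → b⊥m (∣-trans e∣d d∣b , e∣m)) d∣m*m)

  odd-coprime-to-2 : ∀ t → Coprime (suc (t * 2)) 2
  odd-coprime-to-2 t = Coprime.sym (coprime-+-multiple (n∣m*n t) (Coprime.sym (1-coprimeTo 2)))

  data ParityView : ℕ → Set where
    even : ∀ h → ParityView (h * 2)
    odd  : ∀ h → ParityView (suc (h * 2))

  parityView : ∀ n → ParityView n
  parityView zero    = even 0
  parityView (suc n) with parityView n
  ... | even h = odd h
  ... | odd h  = even (suc h)

  -- For odd n take b = 2; for n = 2h take the odd b = h - 1 or h - 2, so that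
  -- n = b · 2 + 2 or n = b · 2 + 4.
  three≤φ-of-large : ∀ n → 5 ≤ n → n ≢ 6 → 3 ≤ φ n
  three≤φ-of-large n 5≤n n≢6 with parityView n
  ... | odd (suc (suc h)) =
    three≤φ 2 (suc (suc h) * 2) (s≤s (s≤s z≤n)) (s≤s (s≤s (s≤s z≤n))) (Coprime.sym (odd-coprime-to-2 (suc (suc h))))
  ... | odd 0             = contradiction 5≤n λ { (s≤s ()) }
  ... | odd 1             = contradiction 5≤n λ { (s≤s (s≤s (s≤s ()))) }
  ... | even h with parityView h
  ...   | even (suc (suc t)) =
    three≤φ (suc (suc t * 2)) _ (s≤s (s≤s z≤n))
            (s≤s (s≤s (s≤s (s≤s (ℕ.m≤n⇒m≤o+n 3 (ℕ.m≤m*n (t * 2) 2))))))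
            (coprime-+-multiple (m∣m*n 2) (odd-coprime-to-2 (suc t)))
  ...   | odd (suc (suc t)) =
    three≤φ (suc (suc t * 2)) _ (s≤s (s≤s z≤n))
            (s≤s (s≤s (s≤s (s≤s (ℕ.m≤n⇒m≤o+n 5 (ℕ.m≤m*n (t * 2) 2))))))
            (coprime-+-multiple (m∣m*n 2) (coprime-to-square (odd-coprime-to-2 (suc t))))
  ...   | even 0 = contradiction 5≤n λ ()
  ...   | even 1 = contradiction 5≤n λ { (s≤s (s≤s (s≤s (s≤s ())))) }
  ...   | odd 0  = contradiction 5≤n λ { (s≤s (s≤s ())) }
  ...   | odd 1  = contradiction refl n≢6

module MöbiusInversion where

  open import Data.Nat using (_*_; _≤_; _<_; _≟_; s≤s; z≤n; NonZero; >-nonZero; >-nonZero⁻¹; nonTrivial⇒n>1)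
  import Data.Nat.Properties as ℕ
  open import Data.Nat.Divisibility using (_∣_; divides; ∣⇒≤; n∣m*n; ∣-trans;
                                           *-cancelʳ-∣; *-monoˡ-∣; ∣m⇒∣m*n)
  open import Data.Nat.DivMod using (_/_; m*n/n≡m)
  open import Data.Nat.Induction using (<-rec)
  open import Data.Nat.Primality using (Prime; prime⇒irreducible; prime⇒nonZero; prime⇒nonTrivial; euclidsLemma)
  open import Data.Nat.Primality.Factorisation using (factorise)
  open import Data.Nat.Coprimality using (Coprime; coprime-divisor)
  open import Data.Integer as ℤ using (_+_; -_)
  import Data.Integer.Properties as ℤ
  open import Algebra.Bundles using (AbelianGroup)
  open import Algebra.Properties.Group (AbelianGroup.group ℤ.+-0-abelianGroup) using (∙-cancelˡ; inverseˡ-unique)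
  open import Data.Nat.ListAction using (product)
  open import Data.List.Relation.Unary.All using (_∷_)
  open import Data.Product using (∃; _,_)
  open import Data.Sum using (_⊎_; inj₁; inj₂)
  open import Function using (_∘_)
  open import Relation.Nullary using (Dec; yes; no; ¬?; contradiction)
  open import Relation.Binary.PropositionalEquality
  open ≡-Reasoning
  open IndexedSums ℤ.+-0-isCommutativeMonoid public

  prime≥2 : ∀ {p} → Prime p → 2 ≤ p
  prime≥2 {p} p-prime = nonTrivial⇒n>1 p ⦃ prime⇒nonTrivial p-prime ⦄

  prime-factor : ∀ n → 2 ≤ n → ∃ λ p → Prime p × p ∣ n
  prime-factor n@(suc _) 2≤n with factorise n
  ... | record { factors = [] ; isFactorisation = n≡1 } = contradiction (sym n≡1) (ℕ.<⇒≢ 2≤n)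
  ... | record { factors = p ∷ ps ; isFactorisation = n≡p*ps ; factorsPrime = p-prime ∷ _ } =
    p , p-prime , divides (product ps) (trans n≡p*ps (ℕ.*-comm p (product ps)))

  prime∤⇒coprime : ∀ {p d} → Prime p → ¬ (p ∣ d) → Coprime d p
  prime∤⇒coprime p-prime p∤d (i∣d , i∣p) with prime⇒irreducible p-prime i∣p
  ... | inj₁ i≡1 = i≡1
  ... | inj₂ refl = contradiction i∣d p∤d

  divisorSum-injective : ∀ (F G : ℕ → ℤ) → (∀ n → 1 ≤ n → divisorSum n F ≡ divisorSum n G) →
                         ∀ n → 1 ≤ n → F n ≡ G n
  divisorSum-injective F G same = <-rec (λ n → 1 ≤ n → F n ≡ G n) step
    where
    step : ∀ n → (∀ {m} → m < n → 1 ≤ m → F m ≡ G m) → 1 ≤ n → F n ≡ G n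
    step (suc m) F≗G-below _ = ∙-cancelˡ (properSum F) (F (suc m)) (G (suc m)) (begin
      properSum F + F (suc m)  ≡⟨ divisorSum-suc m F ⟨
      divisorSum (suc m) F     ≡⟨ same (suc m) (s≤s z≤n) ⟩
      divisorSum (suc m) G     ≡⟨ divisorSum-suc m G ⟩
      properSum G + G (suc m)  ≡⟨ cong (_+ G (suc m)) (sumTo-cong m proper-terms) ⟨
      properSum F + G (suc m)  ∎)
      where
      properSum : (ℕ → ℤ) → ℤ
      properSum H = sumTo m (λ d → when (d ∣? suc m) (H d))
      proper-terms : ∀ d → 1 ≤ d → d ≤ m → when (d ∣? suc m) (F d) ≡ when (d ∣? suc m) (G d)
      proper-terms d 1≤d d≤m with d ∣? suc m
      ... | yes _ = F≗G-below (s≤s d≤m) 1≤d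
      ... | no _  = refl

  divisorSum-multiples : ∀ m k (g : ℕ → ℤ) → 1 ≤ k →
    divisorSum (m * k) (λ d → when (k ∣? d) (g d)) ≡ divisorSum m (λ i → g (i * k))
  divisorSum-multiples m k g 1≤k =
    trans (sumTo-multiples m k _ 1≤k off-multiples) (sumTo-cong m on-multiples)
    where
    instance _ = >-nonZero 1≤k
    off-multiples : ∀ d → ¬ (k ∣ d) → when (d ∣? m * k) (when (k ∣? d) (g d)) ≡ + 0
    off-multiples d k∤d = trans (cong (when (d ∣? m * k)) (when-no (k ∣? d) k∤d)) (when-ε (d ∣? m * k))
    on-multiples : ∀ i → 1 ≤ i → i ≤ m →
      when (i * k ∣? m * k) (when (k ∣? i * k) (g (i * k))) ≡ when (i ∣? m) (g (i * k))
    on-multiples i _ _ = trans (cong (when (i * k ∣? m * k)) (when-yes (k ∣? i * k) (n∣m*n i)))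
                               (when-⇔ (i * k ∣? m * k) (i ∣? m) (*-cancelʳ-∣ k) (*-monoˡ-∣ k))

  divisorSum-prime-free : ∀ m p (g : ℕ → ℤ) → Prime p → 1 ≤ m →
    divisorSum (m * p) (λ d → when (¬? (p ∣? d)) (g d)) ≡ divisorSum m (λ d → when (¬? (p ∣? d)) (g d))
  divisorSum-prime-free m p g p-prime 1≤m =
    trans (sumTo-extend m (m * p) _ (ℕ.m≤m*n m p) beyond-m) (sumTo-cong m up-to-m)
    where
    instance _ = prime⇒nonZero p-prime
    ∣m*p⇒∣m : ∀ {d} → ¬ (p ∣ d) → d ∣ m * p → d ∣ m
    ∣m*p⇒∣m {d} p∤d d∣mp = coprime-divisor (prime∤⇒coprime p-prime p∤d) (subst (d ∣_) (ℕ.*-comm m p) d∣mp)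
    beyond-m : ∀ k → m < k → k ≤ m * p → when (k ∣? m * p) (when (¬? (p ∣? k)) (g k)) ≡ + 0
    beyond-m k m<k _ with p ∣? k
    ... | yes _   = when-ε (k ∣? m * p)
    ... | no p∤k  = when-no (k ∣? m * p) λ k∣mp →
                      ℕ.<⇒≱ m<k (∣⇒≤ ⦃ >-nonZero 1≤m ⦄ (∣m*p⇒∣m p∤k k∣mp))
    up-to-m : ∀ k → 1 ≤ k → k ≤ m →
      when (k ∣? m * p) (when (¬? (p ∣? k)) (g k)) ≡ when (k ∣? m) (when (¬? (p ∣? k)) (g k))
    up-to-m k _ _ with p ∣? k
    ... | yes _  = trans (when-ε (k ∣? m * p)) (sym (when-ε (k ∣? m)))
    ... | no p∤k = when-⇔ (k ∣? m * p) (k ∣? m) (∣m*p⇒∣m p∤k) (∣m⇒∣m*n p)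

  when-split : ∀ {P : Set} (P? : Dec P) x → x ≡ when P? x + when (¬? P?) x
  when-split (yes _) x = sym (ℤ.+-identityʳ x)
  when-split (no _)  x = sym (ℤ.+-identityˡ x)

  divisorSum-split : ∀ n p (g : ℕ → ℤ) →
    divisorSum n g ≡ divisorSum n (λ d → when (p ∣? d) (g d)) + divisorSum n (λ d → when (¬? (p ∣? d)) (g d))
  divisorSum-split n p g =
    trans (sumTo-cong n (λ d _ _ → cong (when (d ∣? n)) (when-split (p ∣? d) (g d))))
          (divisorSum-distrib n _ _)

  divisorSum-neg : ∀ n g → divisorSum n (λ d → - g d) ≡ - divisorSum n g
  divisorSum-neg n g = sym (divisorSum-homo -_ refl ℤ.neg-distrib-+ n g)

  divisorSum-scale : ∀ c n g → divisorSum n (λ d → c ℤ.* g d) ≡ c ℤ.* divisorSum n g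
  divisorSum-scale c n g = sym (divisorSum-homo (c ℤ.*_) (ℤ.*-zeroʳ c) (ℤ.*-distribˡ-+ c) n g)

  dilate : (k : ℕ) → .{{NonZero k}} → (ℕ → ℤ) → ℕ → ℤ
  dilate k f n = when (k ∣? n) (f (n / k))

  divisorSum-dilate-∣ : ∀ m k .{{_ : NonZero k}} f → divisorSum (m * k) (dilate k f) ≡ divisorSum m f
  divisorSum-dilate-∣ m k f =
    trans (divisorSum-multiples m k (λ d → f (d / k)) (>-nonZero⁻¹ k))
          (sumTo-cong m (λ i _ _ → cong (λ j → when (i ∣? m) (f j)) (m*n/n≡m i k)))

  divisorSum-dilate-∤ : ∀ n k .{{_ : NonZero k}} f → ¬ (k ∣ n) → divisorSum n (dilate k f) ≡ + 0
  divisorSum-dilate-∤ n k f k∤n = sumTo-ε n _ λ d _ _ → vanishes d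
    where
    vanishes : ∀ d → when (d ∣? n) (when (k ∣? d) (f (d / k))) ≡ + 0
    vanishes d with d ∣? n | k ∣? d
    ... | yes d∣n | yes k∣d = contradiction (∣-trans k∣d d∣n) k∤n
    ... | yes _   | no _    = refl
    ... | no _    | _       = refl

  -- f is c times the Möbius function, characterised through its divisor sums
  -- (μ itself is never defined).
  module ScaledMöbius (f : ℕ → ℤ) (c : ℤ)
                      (divisorSum-f : ∀ n → 1 ≤ n → divisorSum n f ≡ when (n ≟ 1) c) where

    f-1 : f 1 ≡ c
    f-1 = trans (sym (ℤ.+-identityˡ (f 1))) (divisorSum-f 1 (s≤s z≤n))

    f-*-prime : ∀ {p} → Prime p → ∀ e → 1 ≤ e → f (e * p) ≡ - when (¬? (p ∣? e)) (f e)
    f-*-prime {p} p-prime =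
      divisorSum-injective (λ e → f (e * p)) (λ e → - when (¬? (p ∣? e)) (f e)) same-sums
      where
      instance _ = prime⇒nonZero p-prime
      same-sums : ∀ m → 1 ≤ m →
        divisorSum m (λ e → f (e * p)) ≡ divisorSum m (λ e → - when (¬? (p ∣? e)) (f e))
      same-sums m 1≤m = begin
        divisorSum m (λ e → f (e * p))                         ≡⟨ divisorSum-multiples m p f (>-nonZero⁻¹ p) ⟨
        divisorSum (m * p) (λ d → when (p ∣? d) (f d))         ≡⟨ inverseˡ-unique _ _ multiples+rest≡0 ⟩
        - divisorSum (m * p) (λ d → when (¬? (p ∣? d)) (f d))  ≡⟨ cong -_ (divisorSum-prime-free m p f p-prime 1≤m) ⟩
        - divisorSum m (λ d → when (¬? (p ∣? d)) (f d))        ≡⟨ divisorSum-neg m _ ⟨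
        divisorSum m (λ e → - when (¬? (p ∣? e)) (f e))        ∎
        where
        2≤m*p : 2 ≤ m * p
        2≤m*p = ℕ.≤-trans (prime≥2 p-prime) (ℕ.m≤n*m p m ⦃ >-nonZero 1≤m ⦄)
        multiples+rest≡0 : divisorSum (m * p) (λ d → when (p ∣? d) (f d))
                           + divisorSum (m * p) (λ d → when (¬? (p ∣? d)) (f d)) ≡ + 0
        multiples+rest≡0 = begin
          _                     ≡⟨ divisorSum-split (m * p) p f ⟨
          divisorSum (m * p) f  ≡⟨ divisorSum-f (m * p) (ℕ.≤-trans (s≤s z≤n) 2≤m*p) ⟩
          when (m * p ≟ 1) c    ≡⟨ when-no (m * p ≟ 1) (ℕ.<⇒≢ 2≤m*p ∘ sym) ⟩
          + 0                   ∎

    f-coprime : ∀ {p} → Prime p → ∀ e → 1 ≤ e → ¬ (p ∣ e) → f (e * p) ≡ - f e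
    f-coprime {p} p-prime e 1≤e p∤e = trans (f-*-prime p-prime e 1≤e) (cong -_ (when-yes (¬? (p ∣? e)) p∤e))

    f-divisible : ∀ {p} → Prime p → ∀ e → 1 ≤ e → p ∣ e → f (e * p) ≡ + 0
    f-divisible {p} p-prime e 1≤e p∣e =
      trans (f-*-prime p-prime e 1≤e) (cong -_ (when-no (¬? (p ∣? e)) (λ p∤e → p∤e p∣e)))

    f-square : ∀ {p} → Prime p → ∀ n → 1 ≤ n → p * p ∣ n → f n ≡ + 0
    f-square {p} p-prime n 1≤n (divides q n≡q*[p*p]) = begin
      f n            ≡⟨ cong f (trans n≡q*[p*p] (sym (ℕ.*-assoc q p p))) ⟩
      f (q * p * p)  ≡⟨ f-divisible p-prime (q * p) 1≤q*p (n∣m*n q) ⟩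
      + 0            ∎
      where
      1≤q*p : 1 ≤ q * p
      1≤q*p = ℕ.n≢0⇒n>0 λ q*p≡0 → ℕ.<⇒≢ 1≤n (sym (trans n≡q*[p*p] (trans (sym (ℕ.*-assoc q p p)) (cong (_* p) q*p≡0))))

    Value : ℤ → Set
    Value x = x ≡ c ⊎ x ≡ - c ⊎ x ≡ + 0

    value-*-prime : ∀ {p} → Prime p → ∀ e → 1 ≤ e → Value (f e) → Value (f (e * p))
    value-*-prime {p} p-prime e 1≤e fe with p ∣? e
    ... | yes p∣e = inj₂ (inj₂ (f-divisible p-prime e 1≤e p∣e))
    ... | no p∤e with fe
    ...   | inj₁ fe≡c         = inj₂ (inj₁ (trans (f-coprime p-prime e 1≤e p∤e) (cong -_ fe≡c)))
    ...   | inj₂ (inj₁ fe≡-c) = inj₁ (trans (f-coprime p-prime e 1≤e p∤e)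
                                            (trans (cong -_ fe≡-c) (ℤ.neg-involutive c)))
    ...   | inj₂ (inj₂ fe≡0)  = inj₂ (inj₂ (trans (f-coprime p-prime e 1≤e p∤e) (cong -_ fe≡0)))

    f-values : ∀ n → 1 ≤ n → Value (f n)
    f-values = <-rec (λ n → 1 ≤ n → Value (f n)) step
      where
      step : ∀ n → (∀ {m} → m < n → 1 ≤ m → Value (f m)) → 1 ≤ n → Value (f n)
      step 1                 _     _ = inj₁ f-1
      step n@(suc (suc _)) below _ with prime-factor n (s≤s (s≤s z≤n))
      ... | p , p-prime , divides e n≡e*p =
        subst (Value ∘ f) (sym n≡e*p) (value-*-prime p-prime e 1≤e (below e<n 1≤e))
        where
        1≤e : 1 ≤ e
        1≤e = ℕ.n≢0⇒n>0 λ { refl → ℕ.0≢1+n (sym n≡e*p) }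
        e<n : e < n
        e<n = subst (e <_) (sym n≡e*p) (ℕ.m<m*n e p ⦃ >-nonZero 1≤e ⦄ (prime≥2 p-prime))

    f-*-≢0 : ∀ {p q} → Prime p → Prime q → ¬ (q ∣ p) → ∀ m → 1 ≤ m →
             f (m * q) ≢ + 0 → f (m * p) ≢ + 0 → f (m * p * q) ≢ + 0
    f-*-≢0 {p} {q} p-prime q-prime q∤p m 1≤m f[mq]≢0 f[mp]≢0 f[mpq]≡0 =
      f[mp]≢0 (ℤ.neg-injective (trans (sym (f-coprime q-prime (m * p) 1≤m*p q∤m*p)) f[mpq]≡0))
      where
      1≤m*p : 1 ≤ m * p
      1≤m*p = ℕ.≤-trans 1≤m (ℕ.m≤m*n m p ⦃ prime⇒nonZero p-prime ⦄)
      q∤m*p : ¬ (q ∣ m * p)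
      q∤m*p q∣mp with euclidsLemma m p q-prime q∣mp
      ... | inj₁ q∣m = f[mq]≢0 (f-divisible q-prime m 1≤m q∣m)
      ... | inj₂ q∣p = q∤p q∣p

module Cyclotomic where

  open Jets
  open Polynomials
  open Totient using (φ; divisorSum-φ; three≤φ-of-large)
  open MöbiusInversion using (divisorSum; divisorSum-properDivisors; sumList)
  open import Data.Nat as ℕ using (_∸_; _≤_; _<_; s≤s; z≤n)
  import Data.Nat.Properties as ℕ
  open import Data.Nat.Induction using (<-rec)
  open import Data.Integer using (_+_)
  import Data.Integer.Properties as ℤ
  open import Data.List using (map; foldr; length)
  import Data.List.Properties as List
  open import Data.List.Relation.Unary.All using (All; []; _∷_)
  import Data.List.Relation.Unary.All.Properties as All
  open import Data.Product using (proj₁; proj₂)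
  open import Function using (_∘_)
  open import Relation.Nullary using (yes; no)
  open import Relation.Binary.PropositionalEquality
  open ≡-Reasoning
  private module ℕΣ = IndexedSums ℕ.+-0-isCommutativeMonoid

  product : List Poly → Poly
  product = foldr mulP (+ 1 ∷ [])

  lastPoly-snoc : ∀ xs x → lastPoly (xs ++ x ∷ []) ≡ proj₂ x
  lastPoly-snoc []           x = refl
  lastPoly-snoc (y ∷ [])     x = refl
  lastPoly-snoc (y ∷ z ∷ zs) x = lastPoly-snoc (z ∷ zs) x

  graphΦ : ℕ → ℕ × Poly
  graphΦ k = k , Φ k

  Φ-suc-cycs : ∀ m → Φ (suc m) ≡ divMonic (zPowMinus1 (suc m))
                 (product (map proj₂ (filter (λ dp → proj₁ dp ∣? suc m) (cycs m))))
  Φ-suc-cycs m = lastPoly-snoc (cycs m) _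

  cycs-≡ : ∀ m → cycs m ≡ map graphΦ (range m)
  cycs-≡ zero    = refl
  cycs-≡ (suc m) =
    trans (cong₂ (λ xs p → xs ++ (suc m , p) ∷ []) (cycs-≡ m) (sym (Φ-suc-cycs m)))
          (sym (List.map-++ graphΦ (range m) (suc m ∷ [])))

  filter-graphΦ : ∀ n xs → filter (λ dp → proj₁ dp ∣? n) (map graphΦ xs) ≡ map graphΦ (filter (_∣? n) xs)
  filter-graphΦ n []       = refl
  filter-graphΦ n (x ∷ xs) with x ∣? n
  ... | yes _ = cong (graphΦ x ∷_) (filter-graphΦ n xs)
  ... | no _  = filter-graphΦ n xs

  Φ-suc : ∀ m → Φ (suc m) ≡ divMonic (zPowMinus1 (suc m)) (product (map Φ (properDivisors (suc m))))
  Φ-suc m = begin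
    Φ (suc m)
      ≡⟨ Φ-suc-cycs m ⟩
    divMonic f (product (map proj₂ (filter (λ dp → proj₁ dp ∣? suc m) (cycs m))))
      ≡⟨ cong (λ xs → divMonic f (product (map proj₂ (filter (λ dp → proj₁ dp ∣? suc m) xs)))) (cycs-≡ m) ⟩
    divMonic f (product (map proj₂ (filter (λ dp → proj₁ dp ∣? suc m) (map graphΦ (range m)))))
      ≡⟨ cong (λ xs → divMonic f (product (map proj₂ xs))) (filter-graphΦ (suc m) (range m)) ⟩
    divMonic f (product (map proj₂ (map graphΦ (properDivisors (suc m)))))
      ≡⟨ cong (divMonic f ∘ product) (List.map-∘ (properDivisors (suc m))) ⟨
    divMonic f (product (map Φ (properDivisors (suc m))))
      ∎
    where f = zPowMinus1 (suc m)

  product-monic : ∀ (P : ℕ → Poly) (deg : ℕ → ℕ) ds → All (λ d → MonicOfDegree (deg d) (P d)) ds →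
                  MonicOfDegree (ℕΣ.sumList (map deg ds)) (product (map P ds))
  product-monic P deg []       []       = monic []
  product-monic P deg (d ∷ ds) (m ∷ ms) = mulP-monic m (product-monic P deg ds ms)

  ℓ-product : ∀ {ℓ} → IsAdditiveOnMonic ℓ → ∀ (P : ℕ → Poly) (deg : ℕ → ℕ) ds →
              All (λ d → MonicOfDegree (deg d) (P d)) ds →
              ℓ (jet (product (map P ds))) ≡ sumList (map (ℓ ∘ jet ∘ P) ds)
  ℓ-product additive P deg []       []       = ℓ-1ʲ
    where open IsAdditiveOnMonic additive
  ℓ-product {ℓ} additive P deg (d ∷ ds) (m ∷ ms) = begin
    ℓ (jet (mulP (P d) Πds))           ≡⟨ cong ℓ (jet-mulP (P d) Πds) ⟩
    ℓ (jet (P d) *ʲ jet Πds)           ≡⟨ ℓ-*ʲ (jet (P d)) (jet Πds) (monic⇒jet-monic m)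
                                                (monic⇒jet-monic (product-monic P deg ds ms)) ⟩
    ℓ (jet (P d)) + ℓ (jet Πds)        ≡⟨ cong (λ s → ℓ (jet (P d)) + s) (ℓ-product additive P deg ds ms) ⟩
    ℓ (jet (P d)) + sumList (map (ℓ ∘ jet ∘ P) ds) ∎
    where
    open IsAdditiveOnMonic additive
    Πds = product (map P ds)

  all-range : ∀ {P : ℕ → Set} m → (∀ d → 1 ≤ d → d ≤ m → P d) → All P (range m)
  all-range zero    P-range = []
  all-range (suc m) P-range =
    All.++⁺ (all-range m (λ d 1≤d d≤m → P-range d 1≤d (ℕ.m≤n⇒m≤1+n d≤m))) (P-range (suc m) (s≤s z≤n) ℕ.≤-refl ∷ [])

  all-properDivisors : ∀ {P : ℕ → Set} m → (∀ {d} → d < suc m → 1 ≤ d → P d) → All P (properDivisors (suc m))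
  all-properDivisors m P-below = All.filter⁺ (_∣? suc m) (all-range m (λ d 1≤d d≤m → P-below (s≤s d≤m) 1≤d))

  Φ-monic : ∀ n → 1 ≤ n → MonicOfDegree (φ n) (Φ n)
  Φ-monic = <-rec (λ n → 1 ≤ n → MonicOfDegree (φ n) (Φ n)) step
    where
    step : ∀ n → (∀ {d} → d < n → 1 ≤ d → MonicOfDegree (φ d) (Φ d)) → 1 ≤ n → MonicOfDegree (φ n) (Φ n)
    step (suc m) below _ =
      subst₂ MonicOfDegree n∸G≡φ (sym (Φ-suc m))
        (divMonic-zPowMinus1 (suc m) (s≤s z≤n) G≤n (product-monic Φ φ ds (all-properDivisors m below)))
      where
      ds = properDivisors (suc m)
      G  = ℕΣ.sumList (map φ ds)
      G+φ≡n : G ℕ.+ φ (suc m) ≡ suc m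
      G+φ≡n = trans (sym (ℕΣ.divisorSum-properDivisors m φ)) (divisorSum-φ (suc m) (s≤s z≤n))
      G≤n : G ≤ suc m
      G≤n = subst (G ≤_) G+φ≡n (ℕ.m≤m+n G (φ (suc m)))
      n∸G≡φ : suc m ∸ G ≡ φ (suc m)
      n∸G≡φ = trans (cong (_∸ G) (sym G+φ≡n)) (ℕ.m+n∸m≡n G (φ (suc m)))

  -- Once Φ n has at least four coefficients, the leading four coefficients of
  -- z^n - 1 = Φ n · ∏_{d ∣ n, d < n} Φ d are determined, whatever the remainder.
  divisorSum-ℓ∘Φ : ∀ {ℓ} → IsAdditiveOnMonic ℓ → ∀ n → 1 ≤ n → 3 ≤ φ n →
                   divisorSum n (ℓ ∘ jet ∘ Φ) ≡ ℓ (jet (zPowMinus1 n))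
  divisorSum-ℓ∘Φ {ℓ} additive n@(suc m) 1≤n 3≤φ = begin
    divisorSum n (ℓ ∘ jet ∘ Φ)                       ≡⟨ divisorSum-properDivisors m (ℓ ∘ jet ∘ Φ) ⟩
    sumList (map (ℓ ∘ jet ∘ Φ) ds) + ℓ (jet (Φ n))   ≡⟨ cong (_+ ℓ (jet (Φ n))) (ℓ-product additive Φ φ ds monic-ds) ⟨
    ℓ (jet Πds) + ℓ (jet (Φ n))                      ≡⟨ ℤ.+-comm (ℓ (jet Πds)) (ℓ (jet (Φ n))) ⟩
    ℓ (jet (Φ n)) + ℓ (jet Πds)                      ≡⟨ ℓ-*ʲ (jet (Φ n)) (jet Πds) (monic⇒jet-monic (Φ-monic n 1≤n))
                                                             (monic⇒jet-monic monic-Πds) ⟨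
    ℓ (jet (Φ n) *ʲ jet Πds)                         ≡⟨ cong (λ q → ℓ (jet q *ʲ jet Πds)) (Φ-suc m) ⟩
    ℓ (jet (divMonic f Πds) *ʲ jet Πds)              ≡⟨ cong ℓ (jet-divMonic f monic-Πds 4≤length) ⟨
    ℓ (jet f)                                        ∎
    where
    open IsAdditiveOnMonic additive
    f   = zPowMinus1 n
    ds  = properDivisors n
    Πds = product (map Φ ds)
    monic-ds : All (λ d → MonicOfDegree (φ d) (Φ d)) ds
    monic-ds = all-properDivisors m (λ _ 1≤d → Φ-monic _ 1≤d)
    monic-Πds = product-monic Φ φ ds monic-ds
    4≤length : 4 ≤ length (divMonic f Πds)
    4≤length = subst (λ q → 4 ≤ length q) (Φ-suc m)
                 (subst (4 ≤_) (sym (monic⇒length (Φ-monic n 1≤n))) (s≤s 3≤φ))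

  jet-zPowMinus1 : ∀ {n} → 4 ≤ n → jet (zPowMinus1 n) ≡ 1ʲ
  jet-zPowMinus1 (s≤s (s≤s (s≤s (s≤s _)))) = refl

  -- φ n ≤ 2 only for n = 1, 2, 3, 4, 6; there the divisor sums are evaluated.
  divisorSum-ℓ∘Φ-determined : ∀ {ℓ} → IsAdditiveOnMonic ℓ → (H : ℕ → ℤ) → (∀ k → H (4 ℕ.+ k) ≡ + 0) →
    All (λ n → divisorSum n (ℓ ∘ jet ∘ Φ) ≡ H n) (1 ∷ 2 ∷ 3 ∷ 4 ∷ 6 ∷ []) →
    ∀ n → 1 ≤ n → divisorSum n (ℓ ∘ jet ∘ Φ) ≡ H n
  divisorSum-ℓ∘Φ-determined {ℓ} additive H H-large (h₁ ∷ h₂ ∷ h₃ ∷ h₄ ∷ h₆ ∷ []) = go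
    where
    open IsAdditiveOnMonic additive
    large : ∀ k → 5 ≤ 4 ℕ.+ k → 4 ℕ.+ k ≢ 6 → divisorSum (4 ℕ.+ k) (ℓ ∘ jet ∘ Φ) ≡ H (4 ℕ.+ k)
    large k 5≤n n≢6 = begin
      divisorSum (4 ℕ.+ k) (ℓ ∘ jet ∘ Φ)  ≡⟨ divisorSum-ℓ∘Φ additive (4 ℕ.+ k) (s≤s z≤n) (three≤φ-of-large _ 5≤n n≢6) ⟩
      ℓ (jet (zPowMinus1 (4 ℕ.+ k)))     ≡⟨ cong ℓ (jet-zPowMinus1 (ℕ.m≤m+n 4 k)) ⟩
      ℓ 1ʲ                               ≡⟨ ℓ-1ʲ ⟩
      + 0                                ≡⟨ H-large k ⟨
      H (4 ℕ.+ k)                        ∎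
    go : ∀ n → 1 ≤ n → divisorSum n (ℓ ∘ jet ∘ Φ) ≡ H n
    go 1 _ = h₁
    go 2 _ = h₂
    go 3 _ = h₃
    go 4 _ = h₄
    go 5 _ = large 1 ℕ.≤-refl (λ ())
    go 6 _ = h₆
    go (suc (suc (suc (suc (suc (suc (suc k))))))) _ =
      large (3 ℕ.+ k) (s≤s (s≤s (s≤s (s≤s (s≤s z≤n))))) (λ ())

module Coefficients where

  open Jets
  open Cyclotomic
  open MöbiusInversion
  open import Data.Nat as ℕ using (_≤_; _≟_; s≤s; NonZero; >-nonZero)
  import Data.Nat.Properties as ℕ
  open import Data.Nat.Divisibility using (_∣_; divides; ∣⇒≤; ∣-refl)
  open import Data.Nat.DivMod using (m*n/n≡m)
  open import Data.Nat.Primality using (Prime; prime?; euclidsLemma; prime[2]; prime⇒nonZero)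
  open import Data.Integer using (_+_; _*_)
  import Data.Integer.Properties as ℤ
  open import Data.List.Relation.Unary.All using ([]; _∷_)
  open import Data.Product using (∃; _,_)
  open import Data.Sum using (inj₁; inj₂)
  open import Data.Empty using (⊥)
  open import Function using (_∘_)
  open import Relation.Nullary using (yes; no; contradiction)
  open import Relation.Nullary.Decidable using (from-yes; _×-dec_)
  open import Relation.Binary.PropositionalEquality
  open ≡-Reasoning

  -- rₖ n = newtonₖ (Φ n) is minus the Ramanujan sum c_n(k), the sum of the k-th
  -- powers of the primitive n-th roots of unity.
  r₁ r₂ r₃ : ℕ → ℤ
  r₁ = newton₁ ∘ jet ∘ Φ
  r₂ = newton₂ ∘ jet ∘ Φ
  r₃ = newton₃ ∘ jet ∘ Φ

  divisorSum-r₁ : ∀ n → 1 ≤ n → divisorSum n r₁ ≡ when (n ≟ 1) (-[1+ 0 ])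
  divisorSum-r₁ = divisorSum-ℓ∘Φ-determined newton₁-additive _ (λ _ → refl) (refl ∷ refl ∷ refl ∷ refl ∷ refl ∷ [])

  divisorSum-r₂ : ∀ n → 1 ≤ n → divisorSum n r₂ ≡ when (n ≟ 1) (-[1+ 0 ]) + + 2 * when (n ≟ 2) (-[1+ 0 ])
  divisorSum-r₂ = divisorSum-ℓ∘Φ-determined newton₂-additive _ (λ _ → refl) (refl ∷ refl ∷ refl ∷ refl ∷ refl ∷ [])

  divisorSum-r₃ : ∀ n → 1 ≤ n → divisorSum n r₃ ≡ when (n ≟ 1) (-[1+ 0 ]) + + 3 * when (n ≟ 3) (-[1+ 0 ])
  divisorSum-r₃ = divisorSum-ℓ∘Φ-determined newton₃-additive _ (λ _ → refl) (refl ∷ refl ∷ refl ∷ refl ∷ refl ∷ [])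

  open ScaledMöbius r₁ (-[1+ 0 ]) divisorSum-r₁ public

  divisorSum-dilate-r₁ : ∀ k .{{_ : NonZero k}} n → 1 ≤ n → divisorSum n (dilate k r₁) ≡ when (n ≟ k) (-[1+ 0 ])
  divisorSum-dilate-r₁ k n 1≤n with k ∣? n
  ... | yes (divides q refl) = begin
    divisorSum (q ℕ.* k) (dilate k r₁)  ≡⟨ divisorSum-dilate-∣ q k r₁ ⟩
    divisorSum q r₁                     ≡⟨ divisorSum-r₁ q 1≤q ⟩
    when (q ≟ 1) (-[1+ 0 ])             ≡⟨ when-⇔ (q ≟ 1) (q ℕ.* k ≟ k) (λ { refl → ℕ.*-identityˡ k })
                                                 (λ q*k≡k → ℕ.*-cancelʳ-≡ q 1 k (trans q*k≡k (sym (ℕ.*-identityˡ k)))) ⟩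
    when (q ℕ.* k ≟ k) (-[1+ 0 ])       ∎
    where
    1≤q : 1 ≤ q
    1≤q = ℕ.n≢0⇒n>0 λ { refl → ℕ.<-irrefl refl 1≤n }
  ... | no k∤n = trans (divisorSum-dilate-∤ n k r₁ k∤n) (sym (when-no (n ≟ k) λ { refl → k∤n ∣-refl }))

  -- For prime k this is c_n(k) = μ(n) + k μ(n/k).
  r≡r₁+dilate : ∀ k .{{_ : NonZero k}} (r : ℕ → ℤ) →
    (∀ n → 1 ≤ n → divisorSum n r ≡ when (n ≟ 1) (-[1+ 0 ]) + + k * when (n ≟ k) (-[1+ 0 ])) →
    ∀ n → 1 ≤ n → r n ≡ r₁ n + + k * dilate k r₁ n
  r≡r₁+dilate k r divisorSum-r = divisorSum-injective r (λ n → r₁ n + + k * dilate k r₁ n) λ n 1≤n → begin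
    divisorSum n r                                                        ≡⟨ divisorSum-r n 1≤n ⟩
    when (n ≟ 1) (-[1+ 0 ]) + + k * when (n ≟ k) (-[1+ 0 ])
      ≡⟨ cong₂ (λ x y → x + + k * y) (divisorSum-r₁ n 1≤n) (divisorSum-dilate-r₁ k n 1≤n) ⟨
    divisorSum n r₁ + + k * divisorSum n (dilate k r₁)                    ≡⟨ cong (λ s → divisorSum n r₁ + s) (divisorSum-scale (+ k) n _) ⟨
    divisorSum n r₁ + divisorSum n (λ d → + k * dilate k r₁ d)            ≡⟨ divisorSum-distrib n _ _ ⟨
    divisorSum n (λ d → r₁ d + + k * dilate k r₁ d)                       ∎

  dilate-∣ : ∀ k .{{_ : NonZero k}} (f : ℕ → ℤ) m → dilate k f (m ℕ.* k) ≡ f m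
  dilate-∣ k f m = trans (when-yes (k ∣? m ℕ.* k) (divides m refl)) (cong f (m*n/n≡m m k))

  dilate-value : ∀ k .{{_ : NonZero k}} n → 1 ≤ n → Value (dilate k r₁ n)
  dilate-value k n 1≤n with k ∣? n
  ... | no _                 = inj₂ (inj₂ refl)
  ... | yes (divides q refl) = subst (Value ∘ r₁) (sym (m*n/n≡m q k)) (f-values q 1≤q)
    where
    1≤q : 1 ≤ q
    1≤q = ℕ.n≢0⇒n>0 λ { refl → ℕ.<-irrefl refl 1≤n }

  ¬2∣3 : ¬ (2 ∣ 3)
  ¬2∣3 (divides (suc (suc _)) ())

  prime[3] : Prime 3
  prime[3] = from-yes (prime? 3)

  dilate-≢0⇒∣ : ∀ k .{{_ : NonZero k}} (f : ℕ → ℤ) n → dilate k f n ≢ + 0 → k ∣ n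
  dilate-≢0⇒∣ k f n dilate≢0 with k ∣? n
  ... | yes k∣n = k∣n
  ... | no _    = contradiction refl dilate≢0

  -- With n = 6m: r₁(n/3) = r₁(2m) ≠ 0 makes m odd, and then r₁(n) = -r₁(3m) = -r₁(n/2).
  dilates-not-both-≢0 : ∀ n → 1 ≤ n → r₁ n ≡ + 0 → dilate 2 r₁ n ≢ + 0 → dilate 3 r₁ n ≢ + 0 → ⊥
  dilates-not-both-≢0 n 1≤n r₁n≡0 d₂≢0 d₃≢0
    with dilate-≢0⇒∣ 2 r₁ n d₂≢0 | dilate-≢0⇒∣ 3 r₁ n d₃≢0
  ... | divides h refl | 3∣n with euclidsLemma h 2 prime[3] 3∣n
  ...   | inj₂ 3∣2              = contradiction (∣⇒≤ 3∣2) λ { (s≤s (s≤s ())) }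
  ...   | inj₁ (divides m refl) = f-*-≢0 prime[3] prime[2] ¬2∣3 m 1≤m r₁[2m]≢0 r₁[3m]≢0 r₁n≡0
    where
    1≤m : 1 ≤ m
    1≤m = ℕ.n≢0⇒n>0 λ { refl → ℕ.<-irrefl refl 1≤n }
    r₁[3m]≢0 : r₁ (m ℕ.* 3) ≢ + 0
    r₁[3m]≢0 = d₂≢0 ∘ trans (dilate-∣ 2 r₁ (m ℕ.* 3))
    *-rotate : m ℕ.* 3 ℕ.* 2 ≡ m ℕ.* 2 ℕ.* 3
    *-rotate = trans (ℕ.*-assoc m 3 2) (trans (cong (m ℕ.*_) (ℕ.*-comm 3 2)) (sym (ℕ.*-assoc m 2 3)))
    r₁[2m]≢0 : r₁ (m ℕ.* 2) ≢ + 0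
    r₁[2m]≢0 = d₃≢0 ∘ trans (trans (cong (dilate 3 r₁) *-rotate) (dilate-∣ 3 r₁ (m ℕ.* 2)))

  a₂≡dilate : ∀ n → 1 ≤ n → a 1 n ≡ + 0 → a 2 n ≡ dilate 2 r₁ n
  a₂≡dilate n 1≤n a₁≡0 = ℤ.*-cancelˡ-≡ (+ 2) (a 2 n) (dilate 2 r₁ n) (begin
    + 2 * a 2 n                  ≡⟨ newton₂-of-c₁≡0 (jet (Φ n)) a₁≡0 ⟨
    r₂ n                         ≡⟨ r≡r₁+dilate 2 r₂ divisorSum-r₂ n 1≤n ⟩
    r₁ n + + 2 * dilate 2 r₁ n   ≡⟨ cong (_+ + 2 * dilate 2 r₁ n) a₁≡0 ⟩
    + 0 + + 2 * dilate 2 r₁ n    ≡⟨ ℤ.+-identityˡ _ ⟩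
    + 2 * dilate 2 r₁ n          ∎)

  a₃≡dilate : ∀ n → 1 ≤ n → a 1 n ≡ + 0 → a 3 n ≡ dilate 3 r₁ n
  a₃≡dilate n 1≤n a₁≡0 = ℤ.*-cancelˡ-≡ (+ 3) (a 3 n) (dilate 3 r₁ n) (begin
    + 3 * a 3 n                  ≡⟨ newton₃-of-c₁≡0 (jet (Φ n)) a₁≡0 ⟨
    r₃ n                         ≡⟨ r≡r₁+dilate 3 r₃ divisorSum-r₃ n 1≤n ⟩
    r₁ n + + 3 * dilate 3 r₁ n   ≡⟨ cong (_+ + 3 * dilate 3 r₁ n) a₁≡0 ⟩
    + 0 + + 3 * dilate 3 r₁ n    ≡⟨ ℤ.+-identityˡ _ ⟩
    + 3 * dilate 3 r₁ n          ∎)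

  FiveCases : ℤ × ℤ × ℤ → Set
  FiveCases t = (t ≡ (+ 0 , + 1 , + 0))
              ⊎ (t ≡ (+ 0 , + 0 , + 1))
              ⊎ (t ≡ (+ 0 , + 0 , + 0))
              ⊎ (t ≡ (+ 0 , + 0 , -[1+ 0 ]))
              ⊎ (t ≡ (+ 0 , -[1+ 0 ] , + 0))

  five-cases : ∀ {s₂ s₃} → Value s₂ → Value s₃ → (s₂ ≢ + 0 → s₃ ≢ + 0 → ⊥) → FiveCases (+ 0 , s₂ , s₃)
  five-cases (inj₁ refl)        (inj₂ (inj₂ refl)) _        = inj₂ (inj₂ (inj₂ (inj₂ refl)))
  five-cases (inj₂ (inj₁ refl)) (inj₂ (inj₂ refl)) _        = inj₁ refl
  five-cases (inj₂ (inj₂ refl)) (inj₁ refl)        _        = inj₂ (inj₂ (inj₂ (inj₁ refl)))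
  five-cases (inj₂ (inj₂ refl)) (inj₂ (inj₁ refl)) _        = inj₂ (inj₁ refl)
  five-cases (inj₂ (inj₂ refl)) (inj₂ (inj₂ refl)) _        = inj₂ (inj₂ (inj₁ refl))
  five-cases (inj₁ refl)        (inj₁ refl)        not-both = contradiction (λ ()) (not-both (λ ()))
  five-cases (inj₁ refl)        (inj₂ (inj₁ refl)) not-both = contradiction (λ ()) (not-both (λ ()))
  five-cases (inj₂ (inj₁ refl)) (inj₁ refl)        not-both = contradiction (λ ()) (not-both (λ ()))
  five-cases (inj₂ (inj₁ refl)) (inj₂ (inj₁ refl)) not-both = contradiction (λ ()) (not-both (λ ()))

  square-prime-divisor : ∀ n → 1 ≤ n → ¬ SquareFree n → ∃ λ p → Prime p × p ℕ.* p ∣ n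
  square-prime-divisor n 1≤n ¬squarefree
    with ℕ.anyUpTo? (λ p → prime? p ×-dec p ℕ.* p ∣? n) (suc n)
  ... | yes (p , _ , p-prime , p²∣n) = p , p-prime , p²∣n
  ... | no none = contradiction squarefree ¬squarefree
    where
    squarefree : SquareFree n
    squarefree p p-prime p²∣n = none (p , s≤s p≤n , p-prime , p²∣n)
      where
      p≤n : p ≤ n
      p≤n = ℕ.≤-trans (ℕ.m≤m*n p p ⦃ prime⇒nonZero p-prime ⦄) (∣⇒≤ ⦃ >-nonZero 1≤n ⦄ p²∣n)

open Polynomials using (monic⇒jet-monic)
open Cyclotomic using (Φ-monic)
open MöbiusInversion using (dilate)
open Coefficients

lemma2p3 : (n : ℕ) → n ≥ 1 → ¬ SquareFree n →
    (a 0 n ≡ + 1) ×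
    (((a 1 n , a 2 n , a 3 n) ≡ (+ 0 , + 1 , + 0))
     ⊎ ((a 1 n , a 2 n , a 3 n) ≡ (+ 0 , + 0 , + 1))
     ⊎ ((a 1 n , a 2 n , a 3 n) ≡ (+ 0 , + 0 , + 0))
     ⊎ ((a 1 n , a 2 n , a 3 n) ≡ (+ 0 , + 0 , -[1+ 0 ]))
     ⊎ ((a 1 n , a 2 n , a 3 n) ≡ (+ 0 , -[1+ 0 ] , + 0)))
lemma2p3 n n≥1 ¬squarefree with square-prime-divisor n n≥1 ¬squarefree
... | p , p-prime , p²∣n =
  monic⇒jet-monic (Φ-monic n n≥1) ,
  subst FiveCases (sym (cong₂ _,_ a₁≡0 (cong₂ _,_ (a₂≡dilate n n≥1 a₁≡0) (a₃≡dilate n n≥1 a₁≡0))))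
        (five-cases (dilate-value 2 n n≥1) (dilate-value 3 n n≥1) (dilates-not-both-≢0 n n≥1 a₁≡0))
  where
  a₁≡0 : a 1 n ≡ + 0
  a₁≡0 = f-square p-prime n n≥1 p²∣n
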